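{- The satisfiability problem for $\mathrm{HyperQPTL}$ (given a $\mathrm{HyperQPTL}$ sentence $\phi$, decide whether there exists a nonempty set $T$ of traces with $T\models\phi$) is in $\Sigma^2_1$ (with respect to a standard arithmetically definable encoding of sentences by natural numbers).
   Context: Let $\mathrm{AP}$ be a nonempty finite set of atomic propositions. A trace over $\mathrm{AP}$ is an infinite word $t=t(0)t(1)\cdots$ over the alphabet $2^{\mathrm{AP}}$. Let $\mathcal{V}$ be a countable set of trace variables. $\mathrm{HyperQPTL}$ formulas are given by the grammar $\phi ::= \exists \pi.\,\phi \mid \forall \pi.\,\phi \mid \exists q.\,\phi \mid \forall q.\,\phi \mid \psi$, $\psi ::= p_\pi \mid q \mid \neg\psi \mid \psi\vee\psi \mid \mathbf{X}\psi \mid \mathbf{F}\psi$, with $p,q\in\mathrm{AP}$ and $\pi\in\mathcal{V}$. A sentence is a formula in which every $p_\pi$ lies in the scope of a quantifier binding $\pi$ and every unlabeled $q$ lies in the scope of a quantifier binding $q$. For a trace $t$ and a trace $t_q$ over $\{q\}$, $t[q\mapsto t_q]$ is $t$ with the truth values of $q$ replaced by those of $t_q$; $T[q\mapsto t_q]=\{t[q\mapsto t_q]\mid t\in T\}$. Semantics, for a set $T$ of traces, partial map $\Pi:\mathcal{V}\to(2^{\mathrm{AP}})^\omega$, and $i\in\mathbb{N}$: $T,\Pi,i\models p_\pi$ iff $p\in\Pi(\pi)(i)$; $T,\Pi,i\models q$ iff $q\in t(i)$ for all $t\in T$; Boolean connectives as usual; $\mathbf{X}\psi$ holds at $i$ iff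 $\psi$ holds at $i+1$; $\mathbf{F}\psi$ holds at $i$ iff $\psi$ holds at some $i'\ge i$; $\exists\pi.\phi$ / $\forall\pi.\phi$ quantify over $t\in T$ updating $\Pi[\pi\mapsto t]$; $\exists q.\phi$ / $\forall q.\phi$ quantify over $t_q\in(2^{\{q\}})^\omega$, evaluating $\phi$ over $T[q\mapsto t_q]$. $T\models\phi$ means $T,\Pi_\emptyset,0\models\phi$. $\Sigma^2_1$ is the class of sets of the form $\{n\in\mathbb{N}\mid (\mathbb{N},+,\cdot,<,\in)\models\phi(n)\}$ where $\phi(x)=\exists\mathcal{Y}_1\ldots\exists\mathcal{Y}_k.\,\psi$ with $\mathcal{Y}_j$ third-order variables (ranging over sets of sets of natural numbers) and $\psi$ a formula of arithmetic containing only first-order and second-order quantifiers. -}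

module Defs where

open import Level using (Level; _⊔_) renaming (suc to lsuc; zero to lzero)
open import Data.Nat using (ℕ; zero; suc; _+_; _*_; _<_; _≡ᵇ_)
open import Data.Fin using (Fin; toℕ)
open import Data.Bool using (Bool; true; false; if_then_else_)
open import Data.Maybe using (Maybe; just; nothing)
open import Data.List using (List; []; _∷_)
open import Data.List.Membership.Propositional using (_∈_)
open import Data.Product using (Σ; _×_; _,_; ∃)
open import Data.Sum using (_⊎_)
open import Data.Empty using (⊥)
open import Relation.Nullary using (¬_)
open import Relation.Binary.PropositionalEquality using (_≡_)

-- HyperQPTL over AP = Fin (suc k)   (nonempty finite set of propositions)
-- Trace variables: 𝒱 = ℕ.

Trace : ℕ → Set
Trace k = ℕ → Fin (suc k) → Bool

data Body (k : ℕ) : Set where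
  apv  : Fin (suc k) → ℕ → Body k
  prop : Fin (suc k) → Body k
  neg  : Body k → Body k
  or   : Body k → Body k → Body k
  next : Body k → Body k
  fin  : Body k → Body k

data Formula (k : ℕ) : Set where
  exT  : ℕ → Formula k → Formula k
  allT : ℕ → Formula k → Formula k
  exP  : Fin (suc k) → Formula k → Formula k
  allP : Fin (suc k) → Formula k → Formula k
  body : Body k → Formula k

ClosedB : ∀ {k} → List ℕ → List (Fin (suc k)) → Body k → Set
ClosedB πs qs (apv p π) = π ∈ πs
ClosedB πs qs (prop q)  = q ∈ qs
ClosedB πs qs (neg ψ)   = ClosedB πs qs ψ
ClosedB πs qs (or ψ χ)  = ClosedB πs qs ψ × ClosedB πs qs χ
ClosedB πs qs (next ψ)  = ClosedB πs qs ψ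
ClosedB πs qs (fin ψ)   = ClosedB πs qs ψ

ClosedF : ∀ {k} → List ℕ → List (Fin (suc k)) → Formula k → Set
ClosedF πs qs (exT π φ)  = ClosedF (π ∷ πs) qs φ
ClosedF πs qs (allT π φ) = ClosedF (π ∷ πs) qs φ
ClosedF πs qs (exP q φ)  = ClosedF πs (q ∷ qs) φ
ClosedF πs qs (allP q φ) = ClosedF πs (q ∷ qs) φ
ClosedF πs qs (body ψ)   = ClosedB πs qs ψ

Sentence : ∀ {k} → Formula k → Set
Sentence φ = ClosedF [] [] φ

TraceSet : ℕ → Set₁
TraceSet k = Trace k → Set

Assignment : ℕ → Set
Assignment k = ℕ → Maybe (Trace k)

_[_↦_]ₐ : ∀ {k} → Assignment k → ℕ → Trace k → Assignment k
(Π [ π ↦ t ]ₐ) π' = if π' ≡ᵇ π then just t else Π π'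

-- t[q ↦ t_q]; a trace over {q} is given as ℕ → Bool
_[_↦_]ₜ : ∀ {k} → Trace k → Fin (suc k) → (ℕ → Bool) → Trace k
(t [ q ↦ tq ]ₜ) i p = if toℕ p ≡ᵇ toℕ q then tq i else t i p

_[_↦_]ₛ : ∀ {k} → TraceSet k → Fin (suc k) → (ℕ → Bool) → TraceSet k
(T [ q ↦ tq ]ₛ) t' = Σ _ λ t → T t × (∀ i p → t' i p ≡ (t [ q ↦ tq ]ₜ) i p)

satB : ∀ {k} → TraceSet k → Assignment k → ℕ → Body k → Set
satB T Π i (apv p π) with Π π
... | just t  = t i p ≡ true
... | nothing = ⊥
satB T Π i (prop q)  = ∀ t → T t → t i q ≡ true
satB T Π i (neg ψ)   = ¬ satB T Π i ψ
satB T Π i (or ψ χ)  = satB T Π i ψ ⊎ satB T Π i χ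
satB T Π i (next ψ)  = satB T Π (suc i) ψ
satB T Π i (fin ψ)   = Σ ℕ λ j → (i Data.Nat.≤ j) × satB T Π j ψ

satF : ∀ {k} → TraceSet k → Assignment k → ℕ → Formula k → Set₁
satF T Π i (exT π φ)  = Σ _ λ t → T t × satF T (Π [ π ↦ t ]ₐ) i φ
satF T Π i (allT π φ) = ∀ t → T t → satF T (Π [ π ↦ t ]ₐ) i φ
satF T Π i (exP q φ)  = Σ (ℕ → Bool) λ tq → satF (T [ q ↦ tq ]ₛ) Π i φ
satF T Π i (allP q φ) = ∀ (tq : ℕ → Bool) → satF (T [ q ↦ tq ]ₛ) Π i φ
satF T Π i (body ψ)   = Level.Lift (lsuc lzero) (satB T Π i ψ)

_⊨_ : ∀ {k} → TraceSet k → Formula k → Set₁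
T ⊨ φ = satF T (λ _ → nothing) 0 φ

tri : ℕ → ℕ
tri zero    = zero
tri (suc n) = suc n + tri n

pair : ℕ → ℕ → ℕ
pair a b = tri (a + b) + b

codeB : ∀ {k} → Body k → ℕ
codeB (apv p π) = pair 0 (pair (toℕ p) π)
codeB (prop q)  = pair 1 (toℕ q)
codeB (neg ψ)   = pair 2 (codeB ψ)
codeB (or ψ χ)  = pair 3 (pair (codeB ψ) (codeB χ))
codeB (next ψ)  = pair 4 (codeB ψ)
codeB (fin ψ)   = pair 5 (codeB ψ)

code : ∀ {k} → Formula k → ℕ
code (exT π φ)  = pair 0 (pair π (code φ))
code (allT π φ) = pair 1 (pair π (code φ))
code (exP q φ)  = pair 2 (pair (toℕ q) (code φ))
code (allP q φ) = pair 3 (pair (toℕ q) (code φ))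
code (body ψ)   = pair 4 (codeB ψ)

SatProblem : ℕ → ℕ → Set₁
SatProblem k n = Σ (Formula k) λ φ → code φ ≡ n × Sentence φ ×
                 Σ (TraceSet k) λ T → (Σ _ λ t → T t) × (T ⊨ φ)

-- Third-order arithmetic over (ℕ, +, ·, <, ∈)
-- Sets of naturals: ℕ → Bool; sets of sets of naturals: (ℕ → Bool) → Bool.

SetN : Set
SetN = ℕ → Bool

SetSetN : Set
SetSetN = SetN → Bool

data Term : Set where
  var  : ℕ → Term
  _⊕_  : Term → Term → Term
  _⊗_  : Term → Term → Term

-- Formulas with only first- and second-order quantifiers, and m free
-- third-order variables (Fin m).
data Arith (m : ℕ) : Set where
  _≐_   : Term → Term → Arith m
  _≺_   : Term → Term → Arith m
  _∈₂_  : Term → ℕ → Arith m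
  _∈₃_  : ℕ → Fin m → Arith m
  ¬ₐ    : Arith m → Arith m
  _∧ₐ_  : Arith m → Arith m → Arith m
  _∨ₐ_  : Arith m → Arith m → Arith m
  ∃₁    : ℕ → Arith m → Arith m
  ∀₁    : ℕ → Arith m → Arith m
  ∃₂    : ℕ → Arith m → Arith m
  ∀₂    : ℕ → Arith m → Arith m

upd : ∀ {A : Set} → (ℕ → A) → ℕ → A → ℕ → A
upd e x v y = if y ≡ᵇ x then v else e y

evalT : (ℕ → ℕ) → Term → ℕ
evalT e (var x) = e x
evalT e (s ⊕ t) = evalT e s + evalT e t
evalT e (s ⊗ t) = evalT e s * evalT e t

⟦_⟧ : ∀ {m} → Arith m → (ℕ → ℕ) → (ℕ → SetN) → (Fin m → SetSetN) → Set
⟦ s ≐ t ⟧ e₁ e₂ e₃ = evalT e₁ s ≡ evalT e₁ t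
⟦ s ≺ t ⟧ e₁ e₂ e₃ = evalT e₁ s < evalT e₁ t
⟦ t ∈₂ X ⟧ e₁ e₂ e₃ = e₂ X (evalT e₁ t) ≡ true
⟦ X ∈₃ Y ⟧ e₁ e₂ e₃ = e₃ Y (e₂ X) ≡ true
⟦ ¬ₐ ψ ⟧ e₁ e₂ e₃ = ¬ ⟦ ψ ⟧ e₁ e₂ e₃
⟦ ψ ∧ₐ χ ⟧ e₁ e₂ e₃ = ⟦ ψ ⟧ e₁ e₂ e₃ × ⟦ χ ⟧ e₁ e₂ e₃
⟦ ψ ∨ₐ χ ⟧ e₁ e₂ e₃ = ⟦ ψ ⟧ e₁ e₂ e₃ ⊎ ⟦ χ ⟧ e₁ e₂ e₃
⟦ ∃₁ x ψ ⟧ e₁ e₂ e₃ = Σ ℕ λ n → ⟦ ψ ⟧ (upd e₁ x n) e₂ e₃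
⟦ ∀₁ x ψ ⟧ e₁ e₂ e₃ = ∀ n → ⟦ ψ ⟧ (upd e₁ x n) e₂ e₃
⟦ ∃₂ X ψ ⟧ e₁ e₂ e₃ = Σ SetN λ S → ⟦ ψ ⟧ e₁ (upd e₂ X S) e₃
⟦ ∀₂ X ψ ⟧ e₁ e₂ e₃ = ∀ S → ⟦ ψ ⟧ e₁ (upd e₂ X S) e₃

-- φ(n) = ∃𝒴₀ … ∃𝒴_{m-1}. ψ, where the free first-order variable x is
-- variable 0, instantiated with n (other unbound variables default to 0 / ∅).
Σ21holds : ∀ {m} → Arith m → ℕ → Set
Σ21holds {m} ψ n = Σ (Fin m → SetSetN) λ 𝒴 → ⟦ ψ ⟧ (upd (λ _ → 0) 0 n) (λ _ _ → false) 𝒴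

InΣ21 : ∀ {ℓ} → (ℕ → Set ℓ) → Set ℓ
InΣ21 S = Σ ℕ λ m → Σ (Arith m) λ ψ → ∀ n → (S n → Σ21holds ψ n) × (Σ21holds ψ n → S n)

-- Satisfiability is witnessed by four third-order objects: a family 𝒯 of sets of
-- naturals coding a nonempty model T, and three families S, CB, SB of evaluation
-- states. A state is a set of naturals recording the code of the current subformula,
-- a time point, the trace assignment, and the values chosen so far for quantified
-- propositions (quantifying q replaces q in every trace of T, so the current trace set
-- is T under a finite substitution). The formula says that the initial state of the
-- input code lies in S and that S, CB and SB obey Tarski-style clauses unfolding one
-- connective; since traces, states and codes are sets and numbers, the clauses only
-- quantify over first- and second-order objects.
-- Soundness: unfolding S along strictly decreasing codes decodes a closed formula with
-- the given code, and induction on it shows that it holds in the set coded by 𝒯. The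
-- clauses of S and CB need only be implications, but SB is characterised by an
-- equivalence, which negation requires; CB restricts it to states at closed bodies.
-- Completeness: for a model T of φ, let 𝒯 code T and let S, CB, SB be the states whose
-- formula is closed and true, whose body is closed, resp. closed and true; these sets
-- exist by excluded middle.

module Submission where

open import Defs
open import Level using (Level) renaming (suc to lsuc; zero to lzero)
open import Axiom.ExcludedMiddle using (ExcludedMiddle)
open import Data.Nat using (ℕ)

open import Level using (Lift; lift; lower)
open import Data.Nat using (zero; suc; _+_; _*_; _<_; _≤_; _≡ᵇ_; _<?_; z≤n; s≤s; NonZero)
open import Data.Nat.Properties
  using ( +-comm; +-identityʳ; *-identityˡ; +-mono-≤; +-monoˡ-≤; +-cancelˡ-≡; +-cancelʳ-≡; *-cancelˡ-≡; *-cancelʳ-≡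
        ; ≤-refl; ≤-trans; ≤-<-trans; <-≤-trans; <-cmp; <⇒≢; m≤m+n; m≤n+m; ≮⇒≥; ≤⇒≯; ≡ᵇ⇒≡; ≡⇒≡ᵇ; module ≤-Reasoning)
open import Data.Nat.DivMod using (_%_; [m+kn]%n≡m%n; m<n⇒m%n≡m)
open import Data.Nat.Induction using (<-wellFounded)
open import Data.Nat.Tactic.RingSolver using (solve-∀)
open import Data.Fin using (Fin; toℕ; fromℕ<) renaming (zero to f0; suc to fs)
open import Data.Fin.Properties using (toℕ-injective; toℕ<n; toℕ-fromℕ<)
open import Data.Bool using (Bool; true; false; if_then_else_; T)
open import Data.Bool.Properties using (¬-not)
open import Data.Maybe using (Maybe; just; nothing)
open import Data.Maybe.Relation.Binary.Pointwise as Pointwise using (Pointwise; just; nothing)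
open import Data.List using (List; _∷_)
open import Data.List.Membership.Propositional using (_∈_)
open import Data.List.Relation.Unary.Any using (here; there)
open import Data.Product using (Σ; ∃; _×_; _,_; proj₁; proj₂)
open import Data.Product.Function.NonDependent.Propositional using (_×-⇔_)
open import Data.Sum using (_⊎_; inj₁; inj₂; [_,_]′; map₁)
open import Data.Sum.Function.Propositional using (_⊎-⇔_)
open import Data.Unit using (⊤; tt)
open import Data.Empty using (⊥)
open import Function using (id; _∘_)
open import Function.Bundles using (_⇔_; mk⇔; Equivalence)
open import Function.Construct.Identity using (⇔-id)
open import Function.Construct.Symmetry using (⇔-sym)
open import Function.Properties.Equivalence using () renaming (trans to ⇔-trans)
open import Function.Related.TypeIsomorphisms using (→-cong-⇔)
open import Induction.WellFounded using (Acc; acc)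
open import Relation.Nullary using (¬_; yes; no; contradiction)
open import Relation.Nullary.Decidable using (isYes; True; toWitness)
open import Relation.Binary.Definitions using (tri<; tri≈; tri>)
open import Relation.Binary.PropositionalEquality

open Equivalence using (to; from)

true-⇔-≡ : ∀ {a b} → (a ≡ true ⇔ b ≡ true) → a ≡ b
true-⇔-≡ {true}  {true}  _ = refl
true-⇔-≡ {true}  {false} e = sym (to e refl)
true-⇔-≡ {false} {true}  e = from e refl
true-⇔-≡ {false} {false} _ = refl

≡ᵇ-true⇒≡ : ∀ {m n} → (m ≡ᵇ n) ≡ true → m ≡ n
≡ᵇ-true⇒≡ {m} {n} e = ≡ᵇ⇒≡ m n (subst T (sym e) _)

≡ᵇ-false⇒≢ : ∀ {m n} → (m ≡ᵇ n) ≡ false → ¬ m ≡ n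
≡ᵇ-false⇒≢ {m} {n} e m≡n = subst T e (≡⇒≡ᵇ m n m≡n)

⇔⇒≡-if : ∀ {b x z v : Bool} → (v ≡ true ⇔ ((b ≡ true × x ≡ true) ⊎ (¬ b ≡ true × z ≡ true))) →
          v ≡ (if b then x else z)
⇔⇒≡-if {true}  h = true-⇔-≡ (mk⇔ (λ v → [ proj₂ , (λ (¬t , _) → contradiction refl ¬t) ]′ (to h v))
                                   (λ x → from h (inj₁ (refl , x))))
⇔⇒≡-if {false} h = true-⇔-≡ (mk⇔ (λ v → [ (λ ()) ∘ proj₁ , proj₂ ]′ (to h v))
                                   (λ z → from h (inj₂ ((λ ()) , z))))

≡-if⇒⇔ : ∀ {b x z v : Bool} → v ≡ (if b then x else z) →
          v ≡ true ⇔ ((b ≡ true × x ≡ true) ⊎ (¬ b ≡ true × z ≡ true))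
≡-if⇒⇔ {true}  refl = mk⇔ (λ x → inj₁ (refl , x)) [ proj₂ , (λ (¬t , _) → contradiction refl ¬t) ]′
≡-if⇒⇔ {false} refl = mk⇔ (λ z → inj₂ ((λ ()) , z)) [ (λ ()) ∘ proj₁ , proj₂ ]′

-- Invariance of satisfaction

module _ {k : ℕ} where

  infix 4 _≈ₜ_ _⊑_ _≋_ _≈ₐ_

  _≈ₜ_ : Trace k → Trace k → Set
  t ≈ₜ t' = ∀ i p → t i p ≡ t' i p

  ≈ₜ-refl : ∀ {t} → t ≈ₜ t
  ≈ₜ-refl _ _ = refl

  ≈ₜ-sym : ∀ {t t'} → t ≈ₜ t' → t' ≈ₜ t
  ≈ₜ-sym e i p = sym (e i p)

  ≈ₜ-trans : ∀ {t t' t''} → t ≈ₜ t' → t' ≈ₜ t'' → t ≈ₜ t''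
  ≈ₜ-trans e e' i p = trans (e i p) (e' i p)

  _⊑_ : TraceSet k → TraceSet k → Set
  T₁ ⊑ T₂ = ∀ t → T₁ t → ∃ λ t' → T₂ t' × t ≈ₜ t'

  _≋_ : TraceSet k → TraceSet k → Set
  T₁ ≋ T₂ = T₁ ⊑ T₂ × T₂ ⊑ T₁

  ≋-refl : ∀ {T} → T ≋ T
  ≋-refl = (λ t h → t , h , ≈ₜ-refl) , (λ t h → t , h , ≈ₜ-refl)

  ≋-sym : ∀ {T₁ T₂} → T₁ ≋ T₂ → T₂ ≋ T₁
  ≋-sym (l , r) = r , l

  ⊑-trans : ∀ {T₁ T₂ T₃} → T₁ ⊑ T₂ → T₂ ⊑ T₃ → T₁ ⊑ T₃
  ⊑-trans l l' t h =
    let (t' , h' , e) = l t h ; (t'' , h'' , e') = l' t' h' in t'' , h'' , ≈ₜ-trans e e'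

  ≋-trans : ∀ {T₁ T₂ T₃} → T₁ ≋ T₂ → T₂ ≋ T₃ → T₁ ≋ T₃
  ≋-trans (l , r) (l' , r') = ⊑-trans l l' , ⊑-trans r' r

  _≈ₐ_ : Assignment k → Assignment k → Set
  Π₁ ≈ₐ Π₂ = ∀ π → Pointwise _≈ₜ_ (Π₁ π) (Π₂ π)

  ≈ₐ-refl : ∀ {Π} → Π ≈ₐ Π
  ≈ₐ-refl π = Pointwise.refl ≈ₜ-refl

  ≈ₐ-sym : ∀ {Π₁ Π₂} → Π₁ ≈ₐ Π₂ → Π₂ ≈ₐ Π₁
  ≈ₐ-sym e π = Pointwise.sym ≈ₜ-sym (e π)

  ≈ₐ-trans : ∀ {Π₁ Π₂ Π₃} → Π₁ ≈ₐ Π₂ → Π₂ ≈ₐ Π₃ → Π₁ ≈ₐ Π₃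
  ≈ₐ-trans e e' π = Pointwise.trans ≈ₜ-trans (e π) (e' π)

  [↦]ₐ-cong : ∀ {Π₁ Π₂ t t'} π → Π₁ ≈ₐ Π₂ → t ≈ₜ t' → Π₁ [ π ↦ t ]ₐ ≈ₐ Π₂ [ π ↦ t' ]ₐ
  [↦]ₐ-cong π e e' ρ with ρ ≡ᵇ π
  ... | true  = just e'
  ... | false = e ρ

  [↦]ₜ-cong : ∀ {t t'} q tq → t ≈ₜ t' → t [ q ↦ tq ]ₜ ≈ₜ t' [ q ↦ tq ]ₜ
  [↦]ₜ-cong q tq e i p with toℕ p ≡ᵇ toℕ q
  ... | true  = refl
  ... | false = e i p

  [↦]ₛ-mono : ∀ {T₁ T₂} q tq → T₁ ⊑ T₂ → T₁ [ q ↦ tq ]ₛ ⊑ T₂ [ q ↦ tq ]ₛ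
  [↦]ₛ-mono q tq l t (u , h , e) =
    let (u' , h' , e') = l u h in t , (u' , h' , ≈ₜ-trans e ([↦]ₜ-cong q tq e')) , ≈ₜ-refl

  [↦]ₛ-cong : ∀ {T₁ T₂} q tq → T₁ ≋ T₂ → T₁ [ q ↦ tq ]ₛ ≋ T₂ [ q ↦ tq ]ₛ
  [↦]ₛ-cong q tq (l , r) = [↦]ₛ-mono q tq l , [↦]ₛ-mono q tq r

  satB-cong : ∀ {T₁ T₂ Π₁ Π₂} → T₁ ≋ T₂ → Π₁ ≈ₐ Π₂ → ∀ i ψ → satB T₁ Π₁ i ψ → satB T₂ Π₂ i ψ
  satB-cong {Π₁ = Π₁} {Π₂} _ eΠ i (apv p π) s with Π₁ π | Π₂ π | eΠ π
  ... | just _ | just _ | just e = trans (sym (e i p)) s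
  satB-cong (_ , r) _ i (prop q) s t h = let (t' , h' , e) = r t h in trans (e i q) (s t' h')
  satB-cong eT eΠ i (neg ψ) s s' = s (satB-cong (≋-sym eT) (≈ₐ-sym eΠ) i ψ s')
  satB-cong eT eΠ i (or ψ χ) (inj₁ s) = inj₁ (satB-cong eT eΠ i ψ s)
  satB-cong eT eΠ i (or ψ χ) (inj₂ s) = inj₂ (satB-cong eT eΠ i χ s)
  satB-cong eT eΠ i (next ψ) s = satB-cong eT eΠ (suc i) ψ s
  satB-cong eT eΠ i (fin ψ) (j , i≤j , s) = j , i≤j , satB-cong eT eΠ j ψ s

  satF-cong : ∀ {T₁ T₂ Π₁ Π₂} → T₁ ≋ T₂ → Π₁ ≈ₐ Π₂ → ∀ i φ → satF T₁ Π₁ i φ → satF T₂ Π₂ i φ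
  satF-cong (l , r) eΠ i (exT π φ) (t , h , s) =
    let (t' , h' , e) = l t h in t' , h' , satF-cong (l , r) ([↦]ₐ-cong π eΠ e) i φ s
  satF-cong (l , r) eΠ i (allT π φ) s t h =
    let (t' , h' , e) = r t h in satF-cong (l , r) ([↦]ₐ-cong π eΠ (≈ₜ-sym e)) i φ (s t' h')
  satF-cong eT eΠ i (exP q φ) (tq , s) = tq , satF-cong ([↦]ₛ-cong q tq eT) eΠ i φ s
  satF-cong eT eΠ i (allP q φ) s tq = satF-cong ([↦]ₛ-cong q tq eT) eΠ i φ (s tq)
  satF-cong eT eΠ i (body ψ) (lift s) = lift (satB-cong eT eΠ i ψ s)

-- Nested propositional quantifiers turn T into T[q₁ ↦ t₁]…[qₘ ↦ tₘ]; up to ≋ this is T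
-- under a single finite substitution, which is what a state of the encoding records.
Subst : ℕ → Set
Subst k = Fin (suc k) → Maybe (ℕ → Bool)

override : Maybe (ℕ → Bool) → Bool → ℕ → Bool
override (just f) _ i = f i
override nothing  b _ = b

override-cong : ∀ {a b} → Pointwise _≗_ a b → ∀ x i → override a x i ≡ override b x i
override-cong (just e) _ i = e i
override-cong nothing  _ _ = refl

module _ {k : ℕ} where

  infix 4 _≈σ_

  ∅σ : Subst k
  ∅σ _ = nothing

  _[_↦_]σ : Subst k → Fin (suc k) → (ℕ → Bool) → Subst k
  (σ [ q ↦ tq ]σ) p = if toℕ p ≡ᵇ toℕ q then just tq else σ p

  applyσ : Subst k → Trace k → Trace k
  applyσ σ t i p = override (σ p) (t i p) i

  _⟪_⟫ : TraceSet k → Subst k → TraceSet k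
  (T ⟪ σ ⟫) t = ∃ λ u → T u × t ≈ₜ applyσ σ u

  _≈σ_ : Subst k → Subst k → Set
  σ ≈σ σ' = ∀ p → Pointwise _≗_ (σ p) (σ' p)

  ≈σ-sym : ∀ {σ σ'} → σ ≈σ σ' → σ' ≈σ σ
  ≈σ-sym e p = Pointwise.sym (λ f≗g i → sym (f≗g i)) (e p)

  ⟪⟫-mono : ∀ {T₁ T₂ σ σ'} → T₁ ⊑ T₂ → σ ≈σ σ' → T₁ ⟪ σ ⟫ ⊑ T₂ ⟪ σ' ⟫
  ⟪⟫-mono {σ' = σ'} l eσ t (u , h , e) =
    let (u' , h' , e') = l u h in
    t , (u' , h' , λ i p → trans (e i p) (trans (override-cong (eσ p) (u i p) i)
                                               (cong (λ b → override (σ' p) b i) (e' i p)))) , ≈ₜ-refl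

  ⟪⟫-cong : ∀ {T₁ T₂ σ σ'} → T₁ ≋ T₂ → σ ≈σ σ' → T₁ ⟪ σ ⟫ ≋ T₂ ⟪ σ' ⟫
  ⟪⟫-cong (l , r) eσ = ⟪⟫-mono l eσ , ⟪⟫-mono r (≈σ-sym eσ)

  ⟪∅⟫ : ∀ T → T ⟪ ∅σ ⟫ ≋ T
  ⟪∅⟫ T = (λ t (u , h , e) → u , h , e) , (λ t h → t , (t , h , ≈ₜ-refl) , ≈ₜ-refl)

  applyσ-[↦] : ∀ σ q tq t → applyσ σ t [ q ↦ tq ]ₜ ≈ₜ applyσ (σ [ q ↦ tq ]σ) t
  applyσ-[↦] σ q tq t i p with toℕ p ≡ᵇ toℕ q
  ... | true  = refl
  ... | false = refl

  ⟪⟫-[↦] : ∀ T σ q tq → T ⟪ σ ⟫ [ q ↦ tq ]ₛ ≋ T ⟪ σ [ q ↦ tq ]σ ⟫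
  ⟪⟫-[↦] T σ q tq =
    (λ t (t' , (u , h , e) , e') →
       t , (u , h , ≈ₜ-trans e' (≈ₜ-trans ([↦]ₜ-cong q tq e) (applyσ-[↦] σ q tq u))) , ≈ₜ-refl) ,
    (λ t (u , h , e) →
       t , (applyσ σ u , (u , h , ≈ₜ-refl) , ≈ₜ-trans e (≈ₜ-sym (applyσ-[↦] σ q tq u))) , ≈ₜ-refl)

-- Cantor pairing and codes

tri-mono-≤ : ∀ {s s'} → s ≤ s' → tri s ≤ tri s'
tri-mono-≤ {zero}          _         = z≤n
tri-mono-≤ {suc s} {suc s'} (s≤s s≤s') = +-mono-≤ (s≤s s≤s') (tri-mono-≤ s≤s')

-- The diagonals of the Cantor enumeration do not overlap.
tri+b<tri : ∀ {s s' b} → s < s' → b ≤ s → tri s + b < tri s'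
tri+b<tri {s} {suc s'} {b} (s≤s s≤s') b≤s = begin-strict
  tri s + b    ≤⟨ +-mono-≤ (tri-mono-≤ s≤s') (≤-trans b≤s s≤s') ⟩
  tri s' + s'  ≡⟨ +-comm (tri s') s' ⟩
  s' + tri s'  <⟨ ≤-refl ⟩
  tri (suc s') ∎
  where open ≤-Reasoning

pair-sum-injective : ∀ a a' b b' → pair a b ≡ pair a' b' → a + b ≡ a' + b'
pair-sum-injective a a' b b' eq with <-cmp (a + b) (a' + b')
... | tri≈ _ e _ = e
... | tri< lt _ _ = contradiction eq (<⇒≢ (≤-trans (tri+b<tri lt (m≤n+m b a)) (m≤m+n _ b')))
... | tri> _ _ gt = contradiction (sym eq) (<⇒≢ (≤-trans (tri+b<tri gt (m≤n+m b' a')) (m≤m+n _ b)))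

pair-injective : ∀ {a a' b b'} → pair a b ≡ pair a' b' → a ≡ a' × b ≡ b'
pair-injective {a} {a'} {b} {b'} eq = +-cancelʳ-≡ b a a' (trans s (cong (a' +_) (sym b≡b'))) , b≡b'
  where
  s = pair-sum-injective a a' b b' eq
  b≡b' = +-cancelˡ-≡ (tri (a + b)) b b' (trans eq (cong (λ x → tri x + b') (sym s)))

n≤tri : ∀ n → n ≤ tri n
n≤tri zero    = z≤n
n≤tri (suc n) = m≤m+n (suc n) (tri n)

a≤pair : ∀ a b → a ≤ pair a b
a≤pair a b = ≤-trans (≤-trans (m≤m+n a b) (n≤tri (a + b))) (m≤m+n _ b)

b≤pair : ∀ a b → b ≤ pair a b
b≤pair a b = m≤n+m b (tri (a + b))

b<pair-suc : ∀ a b → b < pair (suc a) b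
b<pair-suc a b = +-monoˡ-≤ b (s≤s z≤n)

-- Every code is a pair (tag , argument); matching on the tag is what
-- rules out the mismatched constructors in the inversion lemmas below.

tagB : ∀ {k} → Body k → ℕ
tagB (apv _ _) = 0
tagB (prop _)  = 1
tagB (neg _)   = 2
tagB (or _ _)  = 3
tagB (next _)  = 4
tagB (fin _)   = 5

argB : ∀ {k} → Body k → ℕ
argB (apv p π) = pair (toℕ p) π
argB (prop q)  = toℕ q
argB (neg ψ)   = codeB ψ
argB (or ψ χ)  = pair (codeB ψ) (codeB χ)
argB (next ψ)  = codeB ψ
argB (fin ψ)   = codeB ψ

codeB-split : ∀ {k} (ψ : Body k) → codeB ψ ≡ pair (tagB ψ) (argB ψ)
codeB-split (apv _ _) = refl
codeB-split (prop _)  = refl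
codeB-split (neg _)   = refl
codeB-split (or _ _)  = refl
codeB-split (next _)  = refl
codeB-split (fin _)   = refl

codeB-inv : ∀ {k} (ψ : Body k) {t a} → codeB ψ ≡ pair t a → tagB ψ ≡ t × argB ψ ≡ a
codeB-inv ψ e = pair-injective (trans (sym (codeB-split ψ)) e)

codeB-injective : ∀ {k} (ψ ψ' : Body k) → codeB ψ ≡ codeB ψ' → ψ ≡ ψ'
codeB-injective ψ ψ' e = go ψ ψ' (codeB-inv ψ (trans e (codeB-split ψ')))
  where
  go : ∀ {k} (ψ ψ' : Body k) → tagB ψ ≡ tagB ψ' × argB ψ ≡ argB ψ' → ψ ≡ ψ'
  go (apv p π) (apv p' π') (refl , e) =
    let (ep , eπ) = pair-injective e in cong₂ apv (toℕ-injective ep) eπ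
  go (prop q) (prop q') (refl , e) = cong prop (toℕ-injective e)
  go (neg ψ)  (neg ψ')  (refl , e) = cong neg (codeB-injective ψ ψ' e)
  go (or ψ χ) (or ψ' χ') (refl , e) =
    let (eψ , eχ) = pair-injective e in cong₂ or (codeB-injective ψ ψ' eψ) (codeB-injective χ χ' eχ)
  go (next ψ) (next ψ') (refl , e) = cong next (codeB-injective ψ ψ' e)
  go (fin ψ)  (fin ψ')  (refl , e) = cong fin (codeB-injective ψ ψ' e)

tagF : ∀ {k} → Formula k → ℕ
tagF (exT _ _)  = 0
tagF (allT _ _) = 1
tagF (exP _ _)  = 2
tagF (allP _ _) = 3
tagF (body _)   = 4

argF : ∀ {k} → Formula k → ℕ
argF (exT π φ)  = pair π (code φ)
argF (allT π φ) = pair π (code φ)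
argF (exP q φ)  = pair (toℕ q) (code φ)
argF (allP q φ) = pair (toℕ q) (code φ)
argF (body ψ)   = codeB ψ

code-split : ∀ {k} (φ : Formula k) → code φ ≡ pair (tagF φ) (argF φ)
code-split (exT _ _)  = refl
code-split (allT _ _) = refl
code-split (exP _ _)  = refl
code-split (allP _ _) = refl
code-split (body _)   = refl

code-inv : ∀ {k} (φ : Formula k) {t a} → code φ ≡ pair t a → tagF φ ≡ t × argF φ ≡ a
code-inv φ e = pair-injective (trans (sym (code-split φ)) e)

b<pair : ∀ a b → 0 < a + b → b < pair a b
b<pair a b 0<a+b = +-monoˡ-≤ b (≤-trans 0<a+b (n≤tri (a + b)))

fst<pair-suc : ∀ t a b → a < pair (suc t) (pair a b)
fst<pair-suc t a b = ≤-<-trans (a≤pair a b) (b<pair-suc t (pair a b))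

snd<pair-suc : ∀ t a b → b < pair (suc t) (pair a b)
snd<pair-suc t a b = ≤-<-trans (b≤pair a b) (b<pair-suc t (pair a b))

code-pos : ∀ {k} (φ : Formula k) → 0 < code φ
code-pos (exT π φ)  = ≤-trans (code-pos φ) (≤-trans (b≤pair π (code φ)) (b≤pair 0 _))
code-pos (allT π φ) = ≤-<-trans z≤n (b<pair-suc 0 (pair π (code φ)))
code-pos (exP q φ)  = ≤-<-trans z≤n (b<pair-suc 1 (pair (toℕ q) (code φ)))
code-pos (allP q φ) = ≤-<-trans z≤n (b<pair-suc 2 (pair (toℕ q) (code φ)))
code-pos (body ψ)   = ≤-<-trans z≤n (b<pair-suc 3 (codeB ψ))

-- exT is the only constructor with tag 0, where positivity of codes is needed.
code<code-exT : ∀ {k} π (φ : Formula k) → code φ < code (exT π φ)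
code<code-exT π φ = <-≤-trans (b<pair π (code φ) (≤-trans (code-pos φ) (m≤n+m _ π))) (b≤pair 0 _)

digits-injective : ∀ n .{{_ : NonZero n}} {r r' j j'} → r < n → r' < n →
                   r + j * n ≡ r' + j' * n → r ≡ r' × j ≡ j'
digits-injective n {r} {r'} {j} {j'} r<n r'<n e = r≡r' , *-cancelʳ-≡ j j' n (+-cancelˡ-≡ r' _ _ e')
  where
  r≡r' : r ≡ r'
  r≡r' = begin
    r                  ≡⟨ m<n⇒m%n≡m r<n ⟨
    r % n              ≡⟨ [m+kn]%n≡m%n r j n ⟨
    (r + j * n) % n    ≡⟨ cong (_% n) e ⟩
    (r' + j' * n) % n  ≡⟨ [m+kn]%n≡m%n r' j' n ⟩
    r' % n             ≡⟨ m<n⇒m%n≡m r'<n ⟩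
    r'                 ∎
    where open ≡-Reasoning
  e' : r' + j * n ≡ r' + j' * n
  e' = trans (cong (_+ j * n) (sym r≡r')) e

insert : {A : Set} → A → (A → Set) → A → Set
insert x P y = y ≡ x ⊎ P y

insert-mono : {A : Set} {P P' : A → Set} {x : A} → (∀ y → P y → P' y) → ∀ y → insert x P y → insert x P' y
insert-mono f y = [ inj₁ , inj₂ ∘ f y ]′

-- ClosedB and ClosedF with the lists of bound variables generalised to predicates,
-- so that the bound variables can be read off a state.
ScopedB : ∀ {k} → (ℕ → Set) → (Fin (suc k) → Set) → Body k → Set
ScopedB A B (apv p π) = A π
ScopedB A B (prop q)  = B q
ScopedB A B (neg ψ)   = ScopedB A B ψ
ScopedB A B (or ψ χ)  = ScopedB A B ψ × ScopedB A B χ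
ScopedB A B (next ψ)  = ScopedB A B ψ
ScopedB A B (fin ψ)   = ScopedB A B ψ

ScopedF : ∀ {k} → (ℕ → Set) → (Fin (suc k) → Set) → Formula k → Set
ScopedF A B (exT π φ)  = ScopedF (insert π A) B φ
ScopedF A B (allT π φ) = ScopedF (insert π A) B φ
ScopedF A B (exP q φ)  = ScopedF A (insert q B) φ
ScopedF A B (allP q φ) = ScopedF A (insert q B) φ
ScopedF A B (body ψ)   = ScopedB A B ψ

module _ {k : ℕ} where

  ScopedB-mono : ∀ {A A' B B'} → (∀ ρ → A ρ → A' ρ) → (∀ q → B q → B' q) →
                 ∀ (ψ : Body k) → ScopedB A B ψ → ScopedB A' B' ψ
  ScopedB-mono f g (apv p π) c       = f π c
  ScopedB-mono f g (prop q)  c       = g q c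
  ScopedB-mono f g (neg ψ)   c       = ScopedB-mono f g ψ c
  ScopedB-mono f g (or ψ χ)  (c , d) = ScopedB-mono f g ψ c , ScopedB-mono f g χ d
  ScopedB-mono f g (next ψ)  c       = ScopedB-mono f g ψ c
  ScopedB-mono f g (fin ψ)   c       = ScopedB-mono f g ψ c

  ScopedF-mono : ∀ {A A' B B'} → (∀ ρ → A ρ → A' ρ) → (∀ q → B q → B' q) →
                 ∀ (φ : Formula k) → ScopedF A B φ → ScopedF A' B' φ
  ScopedF-mono f g (exT π φ)  = ScopedF-mono (insert-mono f) g φ
  ScopedF-mono f g (allT π φ) = ScopedF-mono (insert-mono f) g φ
  ScopedF-mono f g (exP q φ)  = ScopedF-mono f (insert-mono g) φ
  ScopedF-mono f g (allP q φ) = ScopedF-mono f (insert-mono g) φ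
  ScopedF-mono f g (body ψ)   = ScopedB-mono f g ψ

  ∈-∷⇒insert : {A : Set} {xs : List A} {P : A → Set} {x : A} →
               (∀ y → y ∈ xs → P y) → ∀ y → y ∈ x ∷ xs → insert x P y
  ∈-∷⇒insert f y (here e)  = inj₁ e
  ∈-∷⇒insert f y (there m) = inj₂ (f y m)

  insert⇒∈-∷ : {A : Set} {xs : List A} {P : A → Set} {x : A} →
               (∀ y → P y → y ∈ xs) → ∀ y → insert x P y → y ∈ x ∷ xs
  insert⇒∈-∷ f y (inj₁ e) = here e
  insert⇒∈-∷ f y (inj₂ a) = there (f y a)

  ClosedB⇒ScopedB : ∀ {πs qs A B} → (∀ ρ → ρ ∈ πs → A ρ) → (∀ q → q ∈ qs → B q) →
                    ∀ (ψ : Body k) → ClosedB πs qs ψ → ScopedB A B ψ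
  ClosedB⇒ScopedB f g (apv p π) c       = f π c
  ClosedB⇒ScopedB f g (prop q)  c       = g q c
  ClosedB⇒ScopedB f g (neg ψ)   c       = ClosedB⇒ScopedB f g ψ c
  ClosedB⇒ScopedB f g (or ψ χ)  (c , d) = ClosedB⇒ScopedB f g ψ c , ClosedB⇒ScopedB f g χ d
  ClosedB⇒ScopedB f g (next ψ)  c       = ClosedB⇒ScopedB f g ψ c
  ClosedB⇒ScopedB f g (fin ψ)   c       = ClosedB⇒ScopedB f g ψ c

  ScopedB⇒ClosedB : ∀ {πs qs A B} → (∀ ρ → A ρ → ρ ∈ πs) → (∀ q → B q → q ∈ qs) →
                    ∀ (ψ : Body k) → ScopedB A B ψ → ClosedB πs qs ψ
  ScopedB⇒ClosedB f g (apv p π) c       = f π c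
  ScopedB⇒ClosedB f g (prop q)  c       = g q c
  ScopedB⇒ClosedB f g (neg ψ)   c       = ScopedB⇒ClosedB f g ψ c
  ScopedB⇒ClosedB f g (or ψ χ)  (c , d) = ScopedB⇒ClosedB f g ψ c , ScopedB⇒ClosedB f g χ d
  ScopedB⇒ClosedB f g (next ψ)  c       = ScopedB⇒ClosedB f g ψ c
  ScopedB⇒ClosedB f g (fin ψ)   c       = ScopedB⇒ClosedB f g ψ c

  ClosedF⇒ScopedF : ∀ {πs qs A B} → (∀ ρ → ρ ∈ πs → A ρ) → (∀ q → q ∈ qs → B q) →
                    ∀ (φ : Formula k) → ClosedF πs qs φ → ScopedF A B φ
  ClosedF⇒ScopedF f g (exT π φ)  = ClosedF⇒ScopedF (∈-∷⇒insert f) g φ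
  ClosedF⇒ScopedF f g (allT π φ) = ClosedF⇒ScopedF (∈-∷⇒insert f) g φ
  ClosedF⇒ScopedF f g (exP q φ)  = ClosedF⇒ScopedF f (∈-∷⇒insert g) φ
  ClosedF⇒ScopedF f g (allP q φ) = ClosedF⇒ScopedF f (∈-∷⇒insert g) φ
  ClosedF⇒ScopedF f g (body ψ)   = ClosedB⇒ScopedB f g ψ

  ScopedF⇒ClosedF : ∀ {πs qs A B} → (∀ ρ → A ρ → ρ ∈ πs) → (∀ q → B q → q ∈ qs) →
                    ∀ (φ : Formula k) → ScopedF A B φ → ClosedF πs qs φ
  ScopedF⇒ClosedF f g (exT π φ)  = ScopedF⇒ClosedF (insert⇒∈-∷ f) g φ
  ScopedF⇒ClosedF f g (allT π φ) = ScopedF⇒ClosedF (insert⇒∈-∷ f) g φ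
  ScopedF⇒ClosedF f g (exP q φ)  = ScopedF⇒ClosedF f (insert⇒∈-∷ g) φ
  ScopedF⇒ClosedF f g (allP q φ) = ScopedF⇒ClosedF f (insert⇒∈-∷ g) φ
  ScopedF⇒ClosedF f g (body ψ)   = ScopedB⇒ClosedB f g ψ

-- States

-- A state is a set of naturals X whose elements enc s y carry, in slot s, the
-- data of one step of the evaluation: the code of the current subformula, the
-- time point, the trace assignment (its domain and, for each bound π, the trace
-- Π(π) as pairs (π, j·K + p)), and the current substitution of propositions.
slotCode slotTime slotVal slotDom slotSVal slotSDom : ℕ
slotCode  = 0
slotTime  = 1
slotVal   = 2
slotDom   = 3
slotSVal  = 4
slotSDom  = 5

enc : ℕ → ℕ → ℕ
enc s y = s + y * 6

infix 4 _∋[_]_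
_∋[_]_ : SetN → ℕ → ℕ → Set
X ∋[ s ] y = X (enc s y) ≡ true

module States (k : ℕ) where

  K : ℕ
  K = suc k

  lin : ℕ → ℕ → ℕ
  lin j r = r + j * K

  decodeTrace : SetN → Trace k
  decodeTrace Y j p = Y (lin j (toℕ p))

  assignmentOf : SetN → Assignment k
  assignmentOf X π =
    if X (enc slotDom π) then just (λ j p → X (enc slotVal (pair π (lin j (toℕ p))))) else nothing

  substOf : SetN → Subst k
  substOf X q =
    if X (enc slotSDom (toℕ q)) then just (λ j → X (enc slotSVal (lin j (toℕ q)))) else nothing

  record StateAt (X : SetN) (c i : ℕ) : Set where
    field
      at-code : ∀ y → X ∋[ slotCode ] y ⇔ y ≡ c
      at-time : ∀ y → X ∋[ slotTime ] y ⇔ y ≡ i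

  record SameAssignment (X X' : SetN) : Set where
    field
      same-dom : ∀ y → X' ∋[ slotDom ] y ⇔ X ∋[ slotDom ] y
      same-val : ∀ y → X' ∋[ slotVal ] y ⇔ X ∋[ slotVal ] y

  record SameSubst (X X' : SetN) : Set where
    field
      same-sdom : ∀ y → X' ∋[ slotSDom ] y ⇔ X ∋[ slotSDom ] y
      same-sval : ∀ y → X' ∋[ slotSVal ] y ⇔ X ∋[ slotSVal ] y

  record Refocus (X X' : SetN) (d i : ℕ) : Set where
    field
      refocus-at     : StateAt X' d i
      refocus-assign : SameAssignment X X'
      refocus-subst  : SameSubst X X'

  record AssignUpdate (X X' : SetN) (π : ℕ) (Y : SetN) : Set where
    field
      update-dom : ∀ ρ → X' ∋[ slotDom ] ρ ⇔ (ρ ≡ π ⊎ X ∋[ slotDom ] ρ)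
      update-val : ∀ ρ w → X' ∋[ slotVal ] pair ρ w ⇔
                           ((ρ ≡ π × Y w ≡ true) ⊎ (¬ ρ ≡ π × X ∋[ slotVal ] pair ρ w))

  record SubstUpdate (X X' : SetN) (q : ℕ) (Y : SetN) : Set where
    field
      update-sdom : ∀ r → X' ∋[ slotSDom ] r ⇔ (r ≡ q ⊎ X ∋[ slotSDom ] r)
      update-sval : ∀ j r → r < K → X' ∋[ slotSVal ] lin j r ⇔
                            ((r ≡ q × Y j ≡ true) ⊎ (¬ r ≡ q × X ∋[ slotSVal ] lin j r))

  traceSetOf : SetSetN → TraceSet k
  traceSetOf 𝒯 t = Σ SetN λ Z → 𝒯 Z ≡ true × t ≈ₜ decodeTrace Z

  tracesAt : SetSetN → SetN → TraceSet k
  tracesAt 𝒯 X = traceSetOf 𝒯 ⟪ substOf X ⟫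

  -- Y codes a trace of tracesAt 𝒯 X.
  record TraceAt (𝒯 : SetSetN) (X Y : SetN) : Set where
    field
      source    : SetN
      source∈𝒯  : 𝒯 source ≡ true
      overrides : ∀ j r → r < K → Y (lin j r) ≡ true ⇔
        ((X ∋[ slotSDom ] r × X ∋[ slotSVal ] lin j r) ⊎ (¬ X ∋[ slotSDom ] r × source (lin j r) ≡ true))

  open StateAt public
  open SameAssignment public
  open SameSubst public
  open Refocus public
  open AssignUpdate public
  open SubstUpdate public
  open TraceAt public

  override-if : ∀ b f v j → override (if b then just f else nothing) v j ≡ (if b then f j else v)
  override-if true  _ _ _ = refl
  override-if false _ _ _ = refl

  if-just-cong : ∀ {A : Set} {R : A → A → Set} {a b} {f g : A} → a ≡ b → R f g →
                 Pointwise R (if a then just f else nothing) (if b then just g else nothing)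
  if-just-cong {a = true}  refl r = just r
  if-just-cong {a = false} refl r = nothing

  assignmentOf-same : ∀ {X X'} → SameAssignment X X' → assignmentOf X' ≈ₐ assignmentOf X
  assignmentOf-same s π =
    if-just-cong (true-⇔-≡ (same-dom s π)) (λ j p → true-⇔-≡ (same-val s (pair π (lin j (toℕ p)))))

  substOf-same : ∀ {X X'} → SameSubst X X' → substOf X' ≈σ substOf X
  substOf-same s q =
    if-just-cong (true-⇔-≡ (same-sdom s (toℕ q))) (λ j → true-⇔-≡ (same-sval s (lin j (toℕ q))))

  tracesAt-same : ∀ {𝒯 X X'} → SameSubst X X' → tracesAt 𝒯 X' ≋ tracesAt 𝒯 X
  tracesAt-same s = ⟪⟫-cong ≋-refl (substOf-same s)

  ⊎-fst : ∀ {A B C : Set} → A → (B ⊎ (¬ A × C)) → B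
  ⊎-fst _ (inj₁ b)        = b
  ⊎-fst a (inj₂ (¬a , _)) = contradiction a ¬a

  ⊎-snd : ∀ {A B C : Set} → ¬ A → ((A × B) ⊎ C) → C
  ⊎-snd ¬a (inj₁ (a , _)) = contradiction a ¬a
  ⊎-snd _  (inj₂ c)       = c

  ≡-⊎-snd : ∀ {A : Set} {x y : ℕ} → ¬ x ≡ y → (x ≡ y ⊎ A) → A
  ≡-⊎-snd x≢y (inj₁ x≡y) = contradiction x≡y x≢y
  ≡-⊎-snd _   (inj₂ a)   = a

  assignmentOf-update : ∀ {X X' π Y} → AssignUpdate X X' π Y →
                        assignmentOf X' ≈ₐ assignmentOf X [ π ↦ decodeTrace Y ]ₐ
  assignmentOf-update {π = π} u ρ with ρ ≡ᵇ π in eq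
  ... | true  = if-just-cong {b = true} (from (update-dom u ρ) (inj₁ ρ≡π)) λ j p → true-⇔-≡ (mk⇔
                  (proj₂ ∘ ⊎-fst ρ≡π ∘ to (update-val u ρ _))
                  (λ y → from (update-val u ρ _) (inj₁ (ρ≡π , y))))
    where ρ≡π = ≡ᵇ-true⇒≡ eq
  ... | false = if-just-cong
                  (true-⇔-≡ (mk⇔ (≡-⊎-snd ρ≢π ∘ to (update-dom u ρ)) (from (update-dom u ρ) ∘ inj₂)))
                  λ j p → true-⇔-≡ (mk⇔
                    (proj₂ ∘ ⊎-snd ρ≢π ∘ to (update-val u ρ _))
                    (λ x → from (update-val u ρ _) (inj₂ (ρ≢π , x))))
    where ρ≢π = ≡ᵇ-false⇒≢ eq

  substOf-update : ∀ {X X' Y} q → SubstUpdate X X' (toℕ q) Y → substOf X' ≈σ substOf X [ q ↦ Y ]σ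
  substOf-update q u p with toℕ p ≡ᵇ toℕ q in eq
  ... | true  = if-just-cong {b = true} (from (update-sdom u (toℕ p)) (inj₁ p≡q)) λ j → true-⇔-≡ (mk⇔
                  (proj₂ ∘ ⊎-fst p≡q ∘ to (update-sval u j _ (toℕ<n p)))
                  (λ y → from (update-sval u j _ (toℕ<n p)) (inj₁ (p≡q , y))))
    where p≡q = ≡ᵇ-true⇒≡ eq
  ... | false = if-just-cong
                  (true-⇔-≡ (mk⇔ (≡-⊎-snd p≢q ∘ to (update-sdom u (toℕ p))) (from (update-sdom u (toℕ p)) ∘ inj₂)))
                  λ j → true-⇔-≡ (mk⇔
                    (proj₂ ∘ ⊎-snd p≢q ∘ to (update-sval u j _ (toℕ<n p)))
                    (λ x → from (update-sval u j _ (toℕ<n p)) (inj₂ (p≢q , x))))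
    where p≢q = ≡ᵇ-false⇒≢ eq

  TraceAt-sound : ∀ {𝒯 X Y} → TraceAt 𝒯 X Y → tracesAt 𝒯 X (decodeTrace Y)
  TraceAt-sound {X = X} tr = decodeTrace (source tr) , (source tr , source∈𝒯 tr , ≈ₜ-refl) , λ j p →
    trans (⇔⇒≡-if (overrides tr j (toℕ p) (toℕ<n p)))
          (sym (override-if (X (enc slotSDom (toℕ p))) _ _ j))

  tracesAt-update : ∀ {𝒯 X X' Y} q → SubstUpdate X X' (toℕ q) Y → tracesAt 𝒯 X' ≋ tracesAt 𝒯 X [ q ↦ Y ]ₛ
  tracesAt-update {𝒯} {X} {Y = Y} q u =
    ≋-trans (⟪⟫-cong ≋-refl (substOf-update q u)) (≋-sym (⟪⟫-[↦] (traceSetOf 𝒯) (substOf X) q Y))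

  SatB : SetSetN → SetN → ℕ → Body k → Set
  SatB 𝒯 X = satB (tracesAt 𝒯 X) (assignmentOf X)

  SatF : SetSetN → SetN → ℕ → Formula k → Set₁
  SatF 𝒯 X = satF (tracesAt 𝒯 X) (assignmentOf X)

  SatB-refocus : ∀ {𝒯 X X' d j} → Refocus X X' d j → ∀ {i ψ} → SatB 𝒯 X' i ψ ⇔ SatB 𝒯 X i ψ
  SatB-refocus u {i} {ψ} = mk⇔
    (satB-cong (tracesAt-same (refocus-subst u)) (assignmentOf-same (refocus-assign u)) i ψ)
    (satB-cong (≋-sym (tracesAt-same (refocus-subst u))) (≈ₐ-sym (assignmentOf-same (refocus-assign u))) i ψ)

  satB-apv⇔ : ∀ {T : TraceSet k} {X i p π} →
              satB T (assignmentOf X) i (apv p π) ⇔ (X ∋[ slotDom ] π × X ∋[ slotVal ] pair π (lin i (toℕ p)))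
  satB-apv⇔ {X = X} {π = π} with X (enc slotDom π)
  ... | true  = mk⇔ (refl ,_) proj₂
  ... | false = mk⇔ (λ ()) λ ()

  StateAt-unique : ∀ {X c c' i i'} → StateAt X c i → StateAt X c' i' → c ≡ c' × i ≡ i'
  StateAt-unique at at' = to (at-code at' _) (from (at-code at _) refl) , to (at-time at' _) (from (at-time at _) refl)

  assignmentOf-empty : ∀ {X} → (∀ ρ → ¬ X ∋[ slotDom ] ρ) → assignmentOf X ≈ₐ (λ _ → nothing)
  assignmentOf-empty noDom ρ = if-just-cong {b = false} (¬-not (noDom ρ)) ≈ₜ-refl

  substOf-empty : ∀ {X} → (∀ q → ¬ X ∋[ slotSDom ] q) → substOf X ≈σ ∅σ
  substOf-empty noSDom q = if-just-cong {b = false} (¬-not (noSDom (toℕ q))) λ _ → refl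

  ScopedBAt : SetN → Body k → Set
  ScopedBAt X = ScopedB (X ∋[ slotDom ]_) (λ q → X ∋[ slotSDom ] toℕ q)

  ScopedFAt : SetN → Formula k → Set
  ScopedFAt X = ScopedF (X ∋[ slotDom ]_) (λ q → X ∋[ slotSDom ] toℕ q)

  ScopedBAt-refocus : ∀ {X X' d i} → Refocus X X' d i → ∀ ψ → ScopedBAt X ψ → ScopedBAt X' ψ
  ScopedBAt-refocus u = ScopedB-mono (λ ρ → from (same-dom (refocus-assign u) ρ))
                                     (λ q → from (same-sdom (refocus-subst u) (toℕ q)))

  ScopedBAt-unfocus : ∀ {X X' d i} → Refocus X X' d i → ∀ ψ → ScopedBAt X' ψ → ScopedBAt X ψ
  ScopedBAt-unfocus u = ScopedB-mono (λ ρ → to (same-dom (refocus-assign u) ρ))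
                                     (λ q → to (same-sdom (refocus-subst u) (toℕ q)))

module Comprehension (em : ExcludedMiddle (lsuc lzero)) where

  setOf : (ℕ → Set) → SetN
  setOf P y = isYes (em {Lift (lsuc lzero) (P y)})

  setOf-⇔ : ∀ P y → setOf P y ≡ true ⇔ P y
  setOf-⇔ P y with em {Lift (lsuc lzero) (P y)}
  ... | yes (lift p) = mk⇔ (λ _ → p) (λ _ → refl)
  ... | no ¬p        = mk⇔ (λ ()) (λ p → contradiction (lift p) ¬p)

  familyOf : (SetN → Set₁) → SetSetN
  familyOf P X = isYes (em {P X})

  familyOf-⇔ : ∀ P X → familyOf P X ≡ true ⇔ P X
  familyOf-⇔ P X with em {P X}
  ... | yes p = mk⇔ (λ _ → p) (λ _ → refl)
  ... | no ¬p = mk⇔ (λ ()) (λ p → contradiction p ¬p)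

  Slotted : (ℕ → ℕ → Set) → ℕ → Set
  Slotted F y = Σ ℕ λ s → Σ ℕ λ z → s < 6 × y ≡ enc s z × F s z

  mkState : (ℕ → ℕ → Set) → SetN
  mkState F = setOf (Slotted F)

  mkState-∋ : ∀ F s {s<6 : True (s <? 6)} y → mkState F ∋[ s ] y ⇔ F s y
  mkState-∋ F s {s<6} y = mk⇔
    (λ h → let (s' , z , s'<6 , e , f) = to (setOf-⇔ (Slotted F) _) h
               (s≡s' , y≡z) = digits-injective 6 (toWitness s<6) s'<6 e
           in subst₂ F (sym s≡s') (sym y≡z) f)
    (λ f → from (setOf-⇔ (Slotted F) _) (s , y , toWitness s<6 , refl , f))

  slots : ℕ → ℕ → (ℕ → Set) → (ℕ → Set) → (ℕ → Set) → (ℕ → Set) → ℕ → ℕ → Set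
  slots c i V D SV SD 0 z = z ≡ c
  slots c i V D SV SD 1 z = z ≡ i
  slots c i V D SV SD 2 z = V z
  slots c i V D SV SD 3 z = D z
  slots c i V D SV SD 4 z = SV z
  slots c i V D SV SD 5 z = SD z
  slots c i V D SV SD _ z = ⊥

  stateWith : ℕ → ℕ → (ℕ → Set) → (ℕ → Set) → (ℕ → Set) → (ℕ → Set) → SetN
  stateWith c i V D SV SD = mkState (slots c i V D SV SD)

  module _ (k : ℕ) where
    open States k

    stateWith-at : ∀ {c i V D SV SD} → StateAt (stateWith c i V D SV SD) c i
    stateWith-at = record { at-code = mkState-∋ _ slotCode ; at-time = mkState-∋ _ slotTime }

    refocused : SetN → ℕ → ℕ → SetN
    refocused X d i = stateWith d i (X ∋[ slotVal ]_) (X ∋[ slotDom ]_) (X ∋[ slotSVal ]_) (X ∋[ slotSDom ]_)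

    refocused-Refocus : ∀ X d i → Refocus X (refocused X d i) d i
    refocused-Refocus X d i = record
      { refocus-at     = stateWith-at
      ; refocus-assign = record { same-dom = mkState-∋ _ slotDom ; same-val = mkState-∋ _ slotVal }
      ; refocus-subst  = record { same-sdom = mkState-∋ _ slotSDom ; same-sval = mkState-∋ _ slotSVal }
      }

    AssignedVal : SetN → ℕ → SetN → ℕ → Set
    AssignedVal X π Y z = Σ ℕ λ ρ → Σ ℕ λ w → z ≡ pair ρ w ×
                          ((ρ ≡ π × Y w ≡ true) ⊎ (¬ ρ ≡ π × X ∋[ slotVal ] pair ρ w))

    assignedSlots : SetN → ℕ → ℕ → ℕ → SetN → ℕ → ℕ → Set
    assignedSlots X c i π Y =
      slots c i (AssignedVal X π Y) (insert π (X ∋[ slotDom ]_)) (X ∋[ slotSVal ]_) (X ∋[ slotSDom ]_)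

    assigned : SetN → ℕ → ℕ → ℕ → SetN → SetN
    assigned X c i π Y = mkState (assignedSlots X c i π Y)

    assigned-update : ∀ X c i π Y → AssignUpdate X (assigned X c i π Y) π Y
    assigned-update X c i π Y = record
      { update-dom = mkState-∋ _ slotDom
      ; update-val = λ ρ w → mk⇔
          (λ h → let (ρ' , w' , e , v) = to (mkState-∋ (assignedSlots X c i π Y) slotVal (pair ρ w)) h
                     (ρ≡ρ' , w≡w') = pair-injective e
                 in subst₂ (λ ρ w → (ρ ≡ π × Y w ≡ true) ⊎ (¬ ρ ≡ π × X ∋[ slotVal ] pair ρ w))
                           (sym ρ≡ρ') (sym w≡w') v)
          (λ v → from (mkState-∋ _ slotVal _) (ρ , w , refl , v))
      }

    assigned-same : ∀ X c i π Y → SameSubst X (assigned X c i π Y)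
    assigned-same X c i π Y = record { same-sdom = mkState-∋ _ slotSDom ; same-sval = mkState-∋ _ slotSVal }

    SubstitutedVal : SetN → ℕ → SetN → ℕ → Set
    SubstitutedVal X q Y z = Σ ℕ λ j → Σ ℕ λ r → r < K × z ≡ lin j r ×
                             ((r ≡ q × Y j ≡ true) ⊎ (¬ r ≡ q × X ∋[ slotSVal ] lin j r))

    substitutedSlots : SetN → ℕ → ℕ → ℕ → SetN → ℕ → ℕ → Set
    substitutedSlots X c i q Y =
      slots c i (X ∋[ slotVal ]_) (X ∋[ slotDom ]_) (SubstitutedVal X q Y) (insert q (X ∋[ slotSDom ]_))

    substituted : SetN → ℕ → ℕ → ℕ → SetN → SetN
    substituted X c i q Y = mkState (substitutedSlots X c i q Y)

    substituted-update : ∀ X c i q Y → SubstUpdate X (substituted X c i q Y) q Y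
    substituted-update X c i q Y = record
      { update-sdom = mkState-∋ _ slotSDom
      ; update-sval = λ j r r<K → mk⇔
          (λ h → let (j' , r' , r'<K , e , v) = to (mkState-∋ (substitutedSlots X c i q Y) slotSVal (lin j r)) h
                     (r≡r' , j≡j') = digits-injective K r<K r'<K e
                 in subst₂ (λ r j → (r ≡ q × Y j ≡ true) ⊎ (¬ r ≡ q × X ∋[ slotSVal ] lin j r))
                           (sym r≡r') (sym j≡j') v)
          (λ v → from (mkState-∋ _ slotSVal _) (j , r , r<K , refl , v))
      }

    substituted-same : ∀ X c i q Y → SameAssignment X (substituted X c i q Y)
    substituted-same X c i q Y = record { same-dom = mkState-∋ _ slotDom ; same-val = mkState-∋ _ slotVal }

    Holds : Trace k → ℕ → Set
    Holds t y = Σ ℕ λ j → Σ _ λ p → y ≡ lin j (toℕ p) × t j p ≡ true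

    encodeTrace : Trace k → SetN
    encodeTrace t = setOf (Holds t)

    decode-encode : ∀ t → decodeTrace (encodeTrace t) ≈ₜ t
    decode-encode t j p = true-⇔-≡ (mk⇔
      (λ h → let (j' , p' , e , v) = to (setOf-⇔ (Holds t) _) h
                 (p≡p' , j≡j') = digits-injective K (toℕ<n p) (toℕ<n p') e
             in subst₂ (λ j p → t j p ≡ true) (sym j≡j') (sym (toℕ-injective p≡p')) v)
      (λ v → from (setOf-⇔ (Holds t) _) (j , p , refl , v)))

    TraceAt-complete : ∀ {𝒯 X t} → tracesAt 𝒯 X t → TraceAt 𝒯 X (encodeTrace t)
    TraceAt-complete {𝒯} {X} {t} (u , (Z , Z∈𝒯 , u≈Z) , t≈) = record
      { source = Z ; source∈𝒯 = Z∈𝒯 ; overrides = λ j r r<K →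
          subst (λ r → Overrides j r) (toℕ-fromℕ< r<K) (≡-if⇒⇔ (value j (fromℕ< r<K))) }
      where
      Overrides : ℕ → ℕ → Set
      Overrides j r = encodeTrace t (lin j r) ≡ true ⇔
        ((X ∋[ slotSDom ] r × X ∋[ slotSVal ] lin j r) ⊎ (¬ X ∋[ slotSDom ] r × Z (lin j r) ≡ true))
      value : ∀ j p → encodeTrace t (lin j (toℕ p)) ≡
        (if X (enc slotSDom (toℕ p)) then X (enc slotSVal (lin j (toℕ p))) else Z (lin j (toℕ p)))
      value j p = begin
        encodeTrace t (lin j (toℕ p))         ≡⟨ decode-encode t j p ⟩
        t j p                                 ≡⟨ t≈ j p ⟩
        override (substOf X p) (u j p) j      ≡⟨ override-if b _ _ j ⟩
        (if b then _ else u j p)              ≡⟨ cong (if b then _ else_) (u≈Z j p) ⟩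
        (if b then _ else Z (lin j (toℕ p)))  ∎
        where
        open ≡-Reasoning
        b = X (enc slotSDom (toℕ p))

    TraceAt-inhabited : ∀ {𝒯 X Z} → 𝒯 Z ≡ true → Σ SetN (TraceAt 𝒯 X)
    TraceAt-inhabited Z∈𝒯 = encodeTrace _ , TraceAt-complete (_ , (_ , Z∈𝒯 , ≈ₜ-refl) , ≈ₜ-refl)

-- The clauses

module Clauses (k : ℕ) (𝒯 S CB SB : SetSetN) where
  open States k

  AssignStep : SetN → ℕ → ℕ → ℕ → SetN → Set
  AssignStep X c i π Y =
    Σ SetN λ X' → StateAt X' c i × AssignUpdate X X' π Y × SameSubst X X' × S X' ≡ true

  SubstStep : SetN → ℕ → ℕ → ℕ → SetN → Set
  SubstStep X c i q Y =
    Σ SetN λ X' → StateAt X' c i × SameAssignment X X' × SubstUpdate X X' q Y × S X' ≡ true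

  BodyStep : SetN → ℕ → ℕ → Set
  BodyStep X d i = Σ SetN λ X' → Refocus X X' d i × CB X' ≡ true × SB X' ≡ true

  AllCB : SetN → ℕ → Set
  AllCB X d = ∀ i X' → Refocus X X' d i → CB X' ≡ true

  -- The bounds c' < c let soundness decode formulas by well-founded recursion on codes.
  SUnfold : SetN → ℕ → ℕ → Set
  SUnfold X c i =
      (Σ ℕ λ π → Σ ℕ λ c' → c ≡ pair 0 (pair π c') × c' < c ×
         Σ SetN λ Y → TraceAt 𝒯 X Y × AssignStep X c' i π Y)
    ⊎ (Σ ℕ λ π → Σ ℕ λ c' → c ≡ pair 1 (pair π c') × c' < c ×
         (∀ Y → TraceAt 𝒯 X Y → AssignStep X c' i π Y))
    ⊎ (Σ ℕ λ q → Σ ℕ λ c' → c ≡ pair 2 (pair q c') × q < K × c' < c × Σ SetN λ Y → SubstStep X c' i q Y)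
    ⊎ (Σ ℕ λ q → Σ ℕ λ c' → c ≡ pair 3 (pair q c') × q < K × c' < c × (∀ Y → SubstStep X c' i q Y))
    ⊎ (Σ ℕ λ d → c ≡ pair 4 d × d < c × BodyStep X d i)

  CBUnfold : SetN → ℕ → Set
  CBUnfold X c =
      (Σ ℕ λ p → Σ ℕ λ π → c ≡ pair 0 (pair p π) × p < K × X ∋[ slotDom ] π)
    ⊎ (Σ ℕ λ q → c ≡ pair 1 q × q < K × X ∋[ slotSDom ] q)
    ⊎ (Σ ℕ λ d → c ≡ pair 2 d × d < c × AllCB X d)
    ⊎ (Σ ℕ λ d₁ → Σ ℕ λ d₂ → c ≡ pair 3 (pair d₁ d₂) × d₁ < c × d₂ < c × AllCB X d₁ × AllCB X d₂)
    ⊎ (Σ ℕ λ d → c ≡ pair 4 d × d < c × AllCB X d)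
    ⊎ (Σ ℕ λ d → c ≡ pair 5 d × d < c × AllCB X d)

  SBUnfold : SetN → ℕ → ℕ → Set
  SBUnfold X c i =
      (Σ ℕ λ p → Σ ℕ λ π → c ≡ pair 0 (pair p π) × p < K ×
         X ∋[ slotDom ] π × X ∋[ slotVal ] pair π (lin i p))
    ⊎ (Σ ℕ λ q → c ≡ pair 1 q × q < K × X ∋[ slotSDom ] q × (∀ Y → TraceAt 𝒯 X Y → Y (lin i q) ≡ true))
    ⊎ (Σ ℕ λ d → c ≡ pair 2 d × Σ SetN λ X' → Refocus X X' d i × CB X' ≡ true × ¬ SB X' ≡ true)
    ⊎ (Σ ℕ λ d₁ → Σ ℕ λ d₂ → c ≡ pair 3 (pair d₁ d₂) × Σ SetN λ X₁ → Σ SetN λ X₂ →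
         Refocus X X₁ d₁ i × Refocus X X₂ d₂ i × CB X₁ ≡ true × CB X₂ ≡ true × (SB X₁ ≡ true ⊎ SB X₂ ≡ true))
    ⊎ (Σ ℕ λ d → c ≡ pair 4 d × BodyStep X d (suc i))
    ⊎ (Σ ℕ λ d → c ≡ pair 5 d × Σ ℕ λ j → i ≤ j × BodyStep X d j)

  ClauseS : Set
  ClauseS = ∀ X c i → StateAt X c i → S X ≡ true → SUnfold X c i

  ClauseCB : Set
  ClauseCB = ∀ X c i → StateAt X c i → CB X ≡ true → CBUnfold X c

  ClauseSB : Set
  ClauseSB = ∀ X c i → StateAt X c i → CB X ≡ true → SB X ≡ true ⇔ SBUnfold X c i

  Initial : ℕ → Set
  Initial n = Σ SetN λ X₀ → StateAt X₀ n 0 × (∀ ρ → ¬ X₀ ∋[ slotDom ] ρ) ×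
                            (∀ q → ¬ X₀ ∋[ slotSDom ] q) × S X₀ ≡ true

  SStep : SetN → Formula k → ℕ → Set
  SStep X (exT π φ)  i = Σ SetN λ Y → TraceAt 𝒯 X Y × AssignStep X (code φ) i π Y
  SStep X (allT π φ) i = ∀ Y → TraceAt 𝒯 X Y → AssignStep X (code φ) i π Y
  SStep X (exP q φ)  i = Σ SetN λ Y → SubstStep X (code φ) i (toℕ q) Y
  SStep X (allP q φ) i = ∀ Y → SubstStep X (code φ) i (toℕ q) Y
  SStep X (body ψ)   i = BodyStep X (codeB ψ) i

  CBStep : SetN → Body k → Set
  CBStep X (apv p π) = X ∋[ slotDom ] π
  CBStep X (prop q)  = X ∋[ slotSDom ] toℕ q
  CBStep X (neg ψ)   = AllCB X (codeB ψ)
  CBStep X (or ψ χ)  = AllCB X (codeB ψ) × AllCB X (codeB χ)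
  CBStep X (next ψ)  = AllCB X (codeB ψ)
  CBStep X (fin ψ)   = AllCB X (codeB ψ)

  SBStep : SetN → Body k → ℕ → Set
  SBStep X (apv p π) i = X ∋[ slotDom ] π × X ∋[ slotVal ] pair π (lin i (toℕ p))
  SBStep X (prop q)  i = X ∋[ slotSDom ] toℕ q × (∀ Y → TraceAt 𝒯 X Y → Y (lin i (toℕ q)) ≡ true)
  SBStep X (neg ψ)   i = Σ SetN λ X' → Refocus X X' (codeB ψ) i × CB X' ≡ true × ¬ SB X' ≡ true
  SBStep X (or ψ χ)  i = Σ SetN λ X₁ → Σ SetN λ X₂ → Refocus X X₁ (codeB ψ) i × Refocus X X₂ (codeB χ) i ×
                           CB X₁ ≡ true × CB X₂ ≡ true × (SB X₁ ≡ true ⊎ SB X₂ ≡ true)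
  SBStep X (next ψ)  i = BodyStep X (codeB ψ) (suc i)
  SBStep X (fin ψ)   i = Σ ℕ λ j → i ≤ j × BodyStep X (codeB ψ) j

  SUnfold→SStep : ∀ {X i} φ → SUnfold X (code φ) i → SStep X φ i
  SUnfold→SStep φ (inj₁ (π , c' , e , _ , step)) with code-inv φ {0} {pair π c'} e
  SUnfold→SStep (exT π₀ φ) (inj₁ (π , c' , e , _ , step)) | refl , e'
    with pair-injective {π₀} {π} {code φ} {c'} e'
  ... | refl , refl = step
  SUnfold→SStep φ (inj₂ (inj₁ (π , c' , e , _ , step))) with code-inv φ {1} {pair π c'} e
  SUnfold→SStep (allT π₀ φ) (inj₂ (inj₁ (π , c' , e , _ , step))) | refl , e'
    with pair-injective {π₀} {π} {code φ} {c'} e'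
  ... | refl , refl = step
  SUnfold→SStep φ (inj₂ (inj₂ (inj₁ (q , c' , e , _ , _ , step)))) with code-inv φ {2} {pair q c'} e
  SUnfold→SStep (exP q₀ φ) (inj₂ (inj₂ (inj₁ (q , c' , e , _ , _ , step)))) | refl , e'
    with pair-injective {toℕ q₀} {q} {code φ} {c'} e'
  ... | refl , refl = step
  SUnfold→SStep φ (inj₂ (inj₂ (inj₂ (inj₁ (q , c' , e , _ , _ , step))))) with code-inv φ {3} {pair q c'} e
  SUnfold→SStep (allP q₀ φ) (inj₂ (inj₂ (inj₂ (inj₁ (q , c' , e , _ , _ , step))))) | refl , e'
    with pair-injective {toℕ q₀} {q} {code φ} {c'} e'
  ... | refl , refl = step
  SUnfold→SStep φ (inj₂ (inj₂ (inj₂ (inj₂ (d , e , _ , step))))) with code-inv φ {4} {d} e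
  SUnfold→SStep (body _) (inj₂ (inj₂ (inj₂ (inj₂ (d , e , _ , step))))) | refl , refl = step

  SStep→SUnfold : ∀ {X i} φ → SStep X φ i → SUnfold X (code φ) i
  SStep→SUnfold (exT π φ)  step = inj₁ (π , code φ , refl , code<code-exT π φ , step)
  SStep→SUnfold (allT π φ) step = inj₂ (inj₁ (π , code φ , refl , snd<pair-suc 0 π (code φ) , step))
  SStep→SUnfold (exP q φ)  step =
    inj₂ (inj₂ (inj₁ (toℕ q , code φ , refl , toℕ<n q , snd<pair-suc 1 (toℕ q) (code φ) , step)))
  SStep→SUnfold (allP q φ) step =
    inj₂ (inj₂ (inj₂ (inj₁ (toℕ q , code φ , refl , toℕ<n q , snd<pair-suc 2 (toℕ q) (code φ) , step))))
  SStep→SUnfold (body ψ)   step = inj₂ (inj₂ (inj₂ (inj₂ (codeB ψ , refl , b<pair-suc 3 (codeB ψ) , step))))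

  CBUnfold→CBStep : ∀ {X} ψ → CBUnfold X (codeB ψ) → CBStep X ψ
  CBUnfold→CBStep ψ (inj₁ (p , π , e , _ , s)) with codeB-inv ψ {0} {pair p π} e
  CBUnfold→CBStep (apv p₀ π₀) (inj₁ (p , π , e , _ , s)) | refl , e'
    with pair-injective {toℕ p₀} {p} {π₀} {π} e'
  ... | refl , refl = s
  CBUnfold→CBStep ψ (inj₂ (inj₁ (q , e , _ , s))) with codeB-inv ψ {1} {q} e
  CBUnfold→CBStep (prop _) (inj₂ (inj₁ (q , e , _ , s))) | refl , refl = s
  CBUnfold→CBStep ψ (inj₂ (inj₂ (inj₁ (d , e , _ , s)))) with codeB-inv ψ {2} {d} e
  CBUnfold→CBStep (neg _) (inj₂ (inj₂ (inj₁ (d , e , _ , s)))) | refl , refl = s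
  CBUnfold→CBStep ψ (inj₂ (inj₂ (inj₂ (inj₁ (d₁ , d₂ , e , _ , _ , s₁ , s₂))))) with codeB-inv ψ {3} {pair d₁ d₂} e
  CBUnfold→CBStep (or ψ χ) (inj₂ (inj₂ (inj₂ (inj₁ (d₁ , d₂ , e , _ , _ , s₁ , s₂))))) | refl , e'
    with pair-injective {codeB ψ} {d₁} {codeB χ} {d₂} e'
  ... | refl , refl = s₁ , s₂
  CBUnfold→CBStep ψ (inj₂ (inj₂ (inj₂ (inj₂ (inj₁ (d , e , _ , s)))))) with codeB-inv ψ {4} {d} e
  CBUnfold→CBStep (next _) (inj₂ (inj₂ (inj₂ (inj₂ (inj₁ (d , e , _ , s)))))) | refl , refl = s
  CBUnfold→CBStep ψ (inj₂ (inj₂ (inj₂ (inj₂ (inj₂ (d , e , _ , s)))))) with codeB-inv ψ {5} {d} e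
  CBUnfold→CBStep (fin _) (inj₂ (inj₂ (inj₂ (inj₂ (inj₂ (d , e , _ , s)))))) | refl , refl = s

  CBStep→CBUnfold : ∀ {X} ψ → CBStep X ψ → CBUnfold X (codeB ψ)
  CBStep→CBUnfold (apv p π) s = inj₁ (toℕ p , π , refl , toℕ<n p , s)
  CBStep→CBUnfold (prop q)  s = inj₂ (inj₁ (toℕ q , refl , toℕ<n q , s))
  CBStep→CBUnfold (neg ψ)   s = inj₂ (inj₂ (inj₁ (codeB ψ , refl , b<pair-suc 1 (codeB ψ) , s)))
  CBStep→CBUnfold (or ψ χ)  (s₁ , s₂) = inj₂ (inj₂ (inj₂ (inj₁ (codeB ψ , codeB χ , refl ,
    fst<pair-suc 2 (codeB ψ) (codeB χ) , snd<pair-suc 2 (codeB ψ) (codeB χ) , s₁ , s₂))))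
  CBStep→CBUnfold (next ψ)  s = inj₂ (inj₂ (inj₂ (inj₂ (inj₁ (codeB ψ , refl , b<pair-suc 3 (codeB ψ) , s)))))
  CBStep→CBUnfold (fin ψ)   s = inj₂ (inj₂ (inj₂ (inj₂ (inj₂ (codeB ψ , refl , b<pair-suc 4 (codeB ψ) , s)))))

  SBUnfold→SBStep : ∀ {X i} ψ → SBUnfold X (codeB ψ) i → SBStep X ψ i
  SBUnfold→SBStep ψ (inj₁ (p , π , e , _ , s)) with codeB-inv ψ {0} {pair p π} e
  SBUnfold→SBStep (apv p₀ π₀) (inj₁ (p , π , e , _ , s)) | refl , e'
    with pair-injective {toℕ p₀} {p} {π₀} {π} e'
  ... | refl , refl = s
  SBUnfold→SBStep ψ (inj₂ (inj₁ (q , e , _ , s))) with codeB-inv ψ {1} {q} e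
  SBUnfold→SBStep (prop _) (inj₂ (inj₁ (q , e , _ , s))) | refl , refl = s
  SBUnfold→SBStep ψ (inj₂ (inj₂ (inj₁ (d , e , s)))) with codeB-inv ψ {2} {d} e
  SBUnfold→SBStep (neg _) (inj₂ (inj₂ (inj₁ (d , e , s)))) | refl , refl = s
  SBUnfold→SBStep ψ (inj₂ (inj₂ (inj₂ (inj₁ (d₁ , d₂ , e , s))))) with codeB-inv ψ {3} {pair d₁ d₂} e
  SBUnfold→SBStep (or ψ χ) (inj₂ (inj₂ (inj₂ (inj₁ (d₁ , d₂ , e , s))))) | refl , e'
    with pair-injective {codeB ψ} {d₁} {codeB χ} {d₂} e'
  ... | refl , refl = s
  SBUnfold→SBStep ψ (inj₂ (inj₂ (inj₂ (inj₂ (inj₁ (d , e , s)))))) with codeB-inv ψ {4} {d} e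
  SBUnfold→SBStep (next _) (inj₂ (inj₂ (inj₂ (inj₂ (inj₁ (d , e , s)))))) | refl , refl = s
  SBUnfold→SBStep ψ (inj₂ (inj₂ (inj₂ (inj₂ (inj₂ (d , e , s)))))) with codeB-inv ψ {5} {d} e
  SBUnfold→SBStep (fin _) (inj₂ (inj₂ (inj₂ (inj₂ (inj₂ (d , e , s)))))) | refl , refl = s

  SBStep→SBUnfold : ∀ {X i} ψ → SBStep X ψ i → SBUnfold X (codeB ψ) i
  SBStep→SBUnfold (apv p π) s = inj₁ (toℕ p , π , refl , toℕ<n p , s)
  SBStep→SBUnfold (prop q)  s = inj₂ (inj₁ (toℕ q , refl , toℕ<n q , s))
  SBStep→SBUnfold (neg ψ)   s = inj₂ (inj₂ (inj₁ (codeB ψ , refl , s)))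
  SBStep→SBUnfold (or ψ χ)  s = inj₂ (inj₂ (inj₂ (inj₁ (codeB ψ , codeB χ , refl , s))))
  SBStep→SBUnfold (next ψ)  s = inj₂ (inj₂ (inj₂ (inj₂ (inj₁ (codeB ψ , refl , s)))))
  SBStep→SBUnfold (fin ψ)   s = inj₂ (inj₂ (inj₂ (inj₂ (inj₂ (codeB ψ , refl , s)))))

  SBUnfold⇔SBStep : ∀ {X i} ψ → SBUnfold X (codeB ψ) i ⇔ SBStep X ψ i
  SBUnfold⇔SBStep ψ = mk⇔ (SBUnfold→SBStep ψ) (SBStep→SBUnfold ψ)

record Certificate (k n : ℕ) : Set where
  field
    𝒯 S CB SB  : SetSetN
    clauseS    : Clauses.ClauseS k 𝒯 S CB SB
    clauseCB   : Clauses.ClauseCB k 𝒯 S CB SB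
    clauseSB   : Clauses.ClauseSB k 𝒯 S CB SB
    nonempty   : Σ SetN λ Z → 𝒯 Z ≡ true
    initial    : Clauses.Initial k 𝒯 S CB SB n

-- Soundness

module Evaluation (em : ExcludedMiddle (lsuc lzero)) (k : ℕ) (𝒯 S CB SB : SetSetN) where
  open States k
  open Comprehension em
  open Clauses k 𝒯 S CB SB

  SBCorrectAt : Body k → Set
  SBCorrectAt ψ = ∀ X i → StateAt X (codeB ψ) i → CB X ≡ true → SB X ≡ true ⇔ SatB 𝒯 X i ψ

  Immediate : (Body k → Set) → Body k → Set
  Immediate P (apv _ _) = ⊤
  Immediate P (prop _)  = ⊤
  Immediate P (neg ψ)   = P ψ
  Immediate P (or ψ χ)  = P ψ × P χ
  Immediate P (next ψ)  = P ψ
  Immediate P (fin ψ)   = P ψ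

  BodyStep→SatB : ∀ ψ {X j} → SBCorrectAt ψ → BodyStep X (codeB ψ) j → SatB 𝒯 X j ψ
  BodyStep→SatB ψ ok (X' , u , cb , sb) = to (SatB-refocus u {ψ = ψ}) (to (ok X' _ (refocus-at u) cb) sb)

  SatB→BodyStep : ∀ ψ {X j} → SBCorrectAt ψ → AllCB X (codeB ψ) → SatB 𝒯 X j ψ → BodyStep X (codeB ψ) j
  SatB→BodyStep ψ {X} {j} ok all s = X' , u , cb , from (ok X' j (refocus-at u) cb) (from (SatB-refocus u {ψ = ψ}) s)
    where
    X' = refocused k X (codeB ψ) j
    u  = refocused-Refocus k X (codeB ψ) j
    cb = all j X' u

  SBStep⇔SatB : ∀ ψ {X i} → Immediate SBCorrectAt ψ → CBStep X ψ → SBStep X ψ i ⇔ SatB 𝒯 X i ψ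
  SBStep⇔SatB (apv p π) {X} _ _ = ⇔-sym (satB-apv⇔ {T = tracesAt 𝒯 X} {X = X} {π = π})
  SBStep⇔SatB (prop q) {X} {i} _ inDom = mk⇔
    (λ (_ , all) t ht → trans (sym (decode-encode k t i q)) (all (encodeTrace k t) (TraceAt-complete k ht)))
    (λ s → inDom , λ Y tr → s (decodeTrace Y) (TraceAt-sound tr))
  SBStep⇔SatB (neg ψ) {X} {i} ok all = mk⇔
    (λ (X' , u , cb , ¬sb) s → ¬sb (from (ok X' i (refocus-at u) cb) (from (SatB-refocus u {ψ = ψ}) s)))
    (λ ¬s → X' , u , cb , λ sb → ¬s (to (SatB-refocus u {ψ = ψ}) (to (ok X' i (refocus-at u) cb) sb)))
    where
    X' = refocused k X (codeB ψ) i
    u  = refocused-Refocus k X (codeB ψ) i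
    cb = all i X' u
  SBStep⇔SatB (or ψ χ) {X} {i} (okψ , okχ) (allψ , allχ) = mk⇔
    (λ (X₁ , X₂ , u₁ , u₂ , cb₁ , cb₂ , sb) →
       [ inj₁ ∘ BodyStep→SatB ψ okψ ∘ (λ s → X₁ , u₁ , cb₁ , s) ,
         inj₂ ∘ BodyStep→SatB χ okχ ∘ (λ s → X₂ , u₂ , cb₂ , s) ]′ sb)
    (λ s → X₁ , X₂ , u₁ , u₂ , allψ i X₁ u₁ , allχ i X₂ u₂ , side s)
    where
    X₁ = refocused k X (codeB ψ) i
    u₁ = refocused-Refocus k X (codeB ψ) i
    X₂ = refocused k X (codeB χ) i
    u₂ = refocused-Refocus k X (codeB χ) i
    side : SatB 𝒯 X i (or ψ χ) → SB X₁ ≡ true ⊎ SB X₂ ≡ true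
    side (inj₁ s) = inj₁ (proj₂ (proj₂ (proj₂ (SatB→BodyStep ψ okψ allψ s))))
    side (inj₂ s) = inj₂ (proj₂ (proj₂ (proj₂ (SatB→BodyStep χ okχ allχ s))))
  SBStep⇔SatB (next ψ) ok all = mk⇔ (BodyStep→SatB ψ ok) (SatB→BodyStep ψ ok all)
  SBStep⇔SatB (fin ψ)  ok all = mk⇔
    (λ (j , i≤j , step) → j , i≤j , BodyStep→SatB ψ ok step)
    (λ (j , i≤j , s) → j , i≤j , SatB→BodyStep ψ ok all s)

module Soundness (em : ExcludedMiddle (lsuc lzero)) (k n : ℕ) (cert : Certificate k n) where
  open Certificate cert
  open States k
  open Comprehension em
  open Clauses k 𝒯 S CB SB
  open Evaluation em k 𝒯 S CB SB

  SB-correct : ∀ ψ → SBCorrectAt ψ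
  SB-correct ψ X i at cb =
    ⇔-trans (clauseSB X _ i at cb)
   (⇔-trans (SBUnfold⇔SBStep ψ)
            (SBStep⇔SatB ψ (immediate ψ) (CBUnfold→CBStep ψ (clauseCB X _ i at cb))))
    where
    immediate : ∀ ψ → Immediate SBCorrectAt ψ
    immediate (apv _ _) = tt
    immediate (prop _)  = tt
    immediate (neg ψ)   = SB-correct ψ
    immediate (or ψ χ)  = SB-correct ψ , SB-correct χ
    immediate (next ψ)  = SB-correct ψ
    immediate (fin ψ)   = SB-correct ψ

  decodeB : ∀ c → Acc _<_ c → ∀ X i → StateAt X c i → CB X ≡ true → Σ (Body k) λ ψ → codeB ψ ≡ c × ScopedBAt X ψ
  decodeB c (acc rs) X i at cb = decode (clauseCB X c i at cb)
    where
    sub : ∀ d → d < c → AllCB X d → Σ (Body k) λ ψ → codeB ψ ≡ d × ScopedBAt X ψ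
    sub d d<c all =
      let u = refocused-Refocus k X d i
          (ψ , e , sc) = decodeB d (rs d<c) _ i (refocus-at u) (all i _ u)
      in ψ , e , ScopedBAt-unfocus u ψ sc
    decode : CBUnfold X c → Σ (Body k) λ ψ → codeB ψ ≡ c × ScopedBAt X ψ
    decode (inj₁ (p , π , refl , p<K , inDom)) =
      apv (fromℕ< p<K) π , cong (λ p → pair 0 (pair p π)) (toℕ-fromℕ< p<K) , inDom
    decode (inj₂ (inj₁ (q , refl , q<K , inDom))) =
      prop (fromℕ< q<K) , cong (pair 1) (toℕ-fromℕ< q<K) , subst (X ∋[ slotSDom ]_) (sym (toℕ-fromℕ< q<K)) inDom
    decode (inj₂ (inj₂ (inj₁ (d , refl , d<c , all)))) =
      let (ψ , e , sc) = sub d d<c all in neg ψ , cong (pair 2) e , sc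
    decode (inj₂ (inj₂ (inj₂ (inj₁ (d₁ , d₂ , refl , d₁<c , d₂<c , all₁ , all₂))))) =
      let (ψ , e₁ , sc₁) = sub d₁ d₁<c all₁ ; (χ , e₂ , sc₂) = sub d₂ d₂<c all₂
      in or ψ χ , cong₂ (λ a b → pair 3 (pair a b)) e₁ e₂ , sc₁ , sc₂
    decode (inj₂ (inj₂ (inj₂ (inj₂ (inj₁ (d , refl , d<c , all)))))) =
      let (ψ , e , sc) = sub d d<c all in next ψ , cong (pair 4) e , sc
    decode (inj₂ (inj₂ (inj₂ (inj₂ (inj₂ (d , refl , d<c , all)))))) =
      let (ψ , e , sc) = sub d d<c all in fin ψ , cong (pair 5) e , sc

  decodeF : ∀ c → Acc _<_ c → ∀ X i → StateAt X c i → S X ≡ true → Σ (Formula k) λ φ → code φ ≡ c × ScopedFAt X φ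
  decodeF c (acc rs) X i at s = decode (clauseS X c i at s)
    where
    substDom : ∀ {q X' Y} (q<K : q < K) → SubstUpdate X X' q Y →
               ∀ r → X' ∋[ slotSDom ] toℕ r → insert (fromℕ< q<K) (λ r → X ∋[ slotSDom ] toℕ r) r
    substDom q<K update r d with to (update-sdom update (toℕ r)) d
    ... | inj₁ r≡q = inj₁ (toℕ-injective (trans r≡q (sym (toℕ-fromℕ< q<K))))
    ... | inj₂ d'  = inj₂ d'
    decode : SUnfold X c i → Σ (Formula k) λ φ → code φ ≡ c × ScopedFAt X φ
    decode (inj₁ (π , c' , refl , c'<c , _ , _ , X' , at' , update , same , s')) =
      let (φ , e , sc) = decodeF c' (rs c'<c) X' i at' s'
      in exT π φ , cong (λ c → pair 0 (pair π c)) e ,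
         ScopedF-mono (λ ρ → to (update-dom update ρ)) (λ q → to (same-sdom same (toℕ q))) φ sc
    decode (inj₂ (inj₁ (π , c' , refl , c'<c , all))) =
      let (Y , tr) = TraceAt-inhabited k {X = X} (proj₂ nonempty)
          (X' , at' , update , same , s') = all Y tr
          (φ , e , sc) = decodeF c' (rs c'<c) X' i at' s'
      in allT π φ , cong (λ c → pair 1 (pair π c)) e ,
         ScopedF-mono (λ ρ → to (update-dom update ρ)) (λ q → to (same-sdom same (toℕ q))) φ sc
    decode (inj₂ (inj₂ (inj₁ (q , c' , refl , q<K , c'<c , _ , X' , at' , same , update , s')))) =
      let (φ , e , sc) = decodeF c' (rs c'<c) X' i at' s'
      in exP (fromℕ< q<K) φ , cong₂ (λ q c → pair 2 (pair q c)) (toℕ-fromℕ< q<K) e ,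
         ScopedF-mono (λ ρ → to (same-dom same ρ)) (substDom q<K update) φ sc
    decode (inj₂ (inj₂ (inj₂ (inj₁ (q , c' , refl , q<K , c'<c , all))))) =
      let (X' , at' , same , update , s') = all (λ _ → false)
          (φ , e , sc) = decodeF c' (rs c'<c) X' i at' s'
      in allP (fromℕ< q<K) φ , cong₂ (λ q c → pair 3 (pair q c)) (toℕ-fromℕ< q<K) e ,
         ScopedF-mono (λ ρ → to (same-dom same ρ)) (substDom q<K update) φ sc
    decode (inj₂ (inj₂ (inj₂ (inj₂ (d , refl , d<c , X' , u , cb , _))))) =
      let (ψ , e , sc) = decodeB d (<-wellFounded d) X' i (refocus-at u) cb
      in body ψ , cong (pair 4) e , ScopedBAt-unfocus u ψ sc

  S-sound : ∀ φ X i → StateAt X (code φ) i → S X ≡ true → SatF 𝒯 X i φ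
  S-sound φ X i at s = sound φ (SUnfold→SStep φ (clauseS X (code φ) i at s))
    where
    sound : ∀ φ → SStep X φ i → SatF 𝒯 X i φ
    sound (exT π φ) (Y , tr , X' , at' , update , same , s') =
      decodeTrace Y , TraceAt-sound tr ,
      satF-cong (tracesAt-same same) (assignmentOf-update update) i φ (S-sound φ X' i at' s')
    sound (allT π φ) step t t∈ =
      let (X' , at' , update , same , s') = step (encodeTrace k t) (TraceAt-complete k t∈)
      in satF-cong (tracesAt-same same)
                   (≈ₐ-trans (assignmentOf-update update) ([↦]ₐ-cong π ≈ₐ-refl (decode-encode k t))) i φ
                   (S-sound φ X' i at' s')
    sound (exP q φ) (Y , X' , at' , same , update , s') =
      Y , satF-cong (tracesAt-update q update) (assignmentOf-same same) i φ (S-sound φ X' i at' s')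
    sound (allP q φ) step Y =
      let (X' , at' , same , update , s') = step Y
      in satF-cong (tracesAt-update q update) (assignmentOf-same same) i φ (S-sound φ X' i at' s')
    sound (body ψ) step = lift (BodyStep→SatB ψ (SB-correct ψ) step)

  satisfiable : SatProblem k n
  satisfiable with initial | nonempty
  ... | X₀ , at₀ , noDom , noSDom , s₀ | Z , Z∈𝒯 =
    φ , code≡n ,
    ScopedF⇒ClosedF (λ ρ d → contradiction d (noDom ρ)) (λ q d → contradiction d (noSDom (toℕ q))) φ sc ,
    traceSetOf 𝒯 , (decodeTrace Z , Z , Z∈𝒯 , ≈ₜ-refl) ,
    satF-cong (≋-trans (⟪⟫-cong ≋-refl (substOf-empty {X₀} noSDom)) (⟪∅⟫ _)) (assignmentOf-empty {X₀} noDom) 0 φ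
              (S-sound φ X₀ 0 (subst (λ c → StateAt X₀ c 0) (sym code≡n) at₀) s₀)
    where
    decoded = decodeF n (<-wellFounded n) X₀ 0 at₀ s₀
    φ = proj₁ decoded
    code≡n = proj₁ (proj₂ decoded)
    sc = proj₂ (proj₂ decoded)

-- Completeness

module Completeness (em : ExcludedMiddle (lsuc lzero)) (k : ℕ) (T : TraceSet k) where
  open States k
  open Comprehension em

  InT : SetN → Set₁
  InT Z = Lift (lsuc lzero) (Σ (Trace k) λ t → T t × decodeTrace Z ≈ₜ t)

  𝒯 : SetSetN
  𝒯 = familyOf InT

  InS : SetN → Set₁
  InS X = Σ ℕ λ i → Σ (Formula k) λ φ → StateAt X (code φ) i × ScopedFAt X φ × SatF 𝒯 X i φ

  InCB : SetN → Set₁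
  InCB X = Lift (lsuc lzero) (Σ ℕ λ i → Σ (Body k) λ ψ → StateAt X (codeB ψ) i × ScopedBAt X ψ)

  InSB : SetN → Set₁
  InSB X = Lift (lsuc lzero) (Σ ℕ λ i → Σ (Body k) λ ψ → StateAt X (codeB ψ) i × ScopedBAt X ψ × SatB 𝒯 X i ψ)

  S CB SB : SetSetN
  S  = familyOf InS
  CB = familyOf InCB
  SB = familyOf InSB

  open Clauses k 𝒯 S CB SB
  open Evaluation em k 𝒯 S CB SB

  traceSetOf-𝒯 : traceSetOf 𝒯 ≋ T
  traceSetOf-𝒯 =
    (λ t (Z , Z∈𝒯 , t≈Z) → let (u , u∈T , Z≈u) = lower (to (familyOf-⇔ InT Z) Z∈𝒯)
                           in u , u∈T , ≈ₜ-trans t≈Z Z≈u) ,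
    (λ t t∈T → t , (encodeTrace k t , 𝒯-encodeTrace t∈T , ≈ₜ-sym (decode-encode k t)) , ≈ₜ-refl)
    where
    𝒯-encodeTrace : ∀ {t} → T t → 𝒯 (encodeTrace k t) ≡ true
    𝒯-encodeTrace {t} t∈T = from (familyOf-⇔ InT (encodeTrace k t)) (lift (t , t∈T , decode-encode k t))

  CB-scoped : ∀ {X i} ψ → StateAt X (codeB ψ) i → CB X ≡ true → ScopedBAt X ψ
  CB-scoped ψ at cb with lower (to (familyOf-⇔ InCB _) cb)
  ... | i' , ψ' , at' , sc with codeB-injective ψ' ψ (proj₁ (StateAt-unique at' at))
  ... | refl = sc

  scoped⇒CB : ∀ {X i} ψ → StateAt X (codeB ψ) i → ScopedBAt X ψ → CB X ≡ true
  scoped⇒CB ψ at sc = from (familyOf-⇔ InCB _) (lift (_ , ψ , at , sc))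

  SB-canonical : ∀ ψ → SBCorrectAt ψ
  SB-canonical ψ X i at cb = mk⇔ sound complete
    where
    sound : SB X ≡ true → SatB 𝒯 X i ψ
    sound sb with lower (to (familyOf-⇔ InSB _) sb)
    ... | i' , ψ' , at' , _ , s with StateAt-unique at' at
    ... | c≡c , refl with codeB-injective ψ' ψ c≡c
    ... | refl = s
    complete : SatB 𝒯 X i ψ → SB X ≡ true
    complete s = from (familyOf-⇔ InSB _) (lift (i , ψ , at , CB-scoped ψ at cb , s))

  AllCB-scoped : ∀ {X} ψ → ScopedBAt X ψ → AllCB X (codeB ψ)
  AllCB-scoped ψ sc j X' u = scoped⇒CB ψ (refocus-at u) (ScopedBAt-refocus u ψ sc)

  scoped⇒CBStep : ∀ {X} ψ → ScopedBAt X ψ → CBStep X ψ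
  scoped⇒CBStep (apv _ _) sc        = sc
  scoped⇒CBStep (prop _)  sc        = sc
  scoped⇒CBStep (neg ψ)   sc        = AllCB-scoped ψ sc
  scoped⇒CBStep (or ψ χ)  (sψ , sχ) = AllCB-scoped ψ sψ , AllCB-scoped χ sχ
  scoped⇒CBStep (next ψ)  sc        = AllCB-scoped ψ sc
  scoped⇒CBStep (fin ψ)   sc        = AllCB-scoped ψ sc

  immediate : ∀ ψ → Immediate SBCorrectAt ψ
  immediate (apv _ _) = tt
  immediate (prop _)  = tt
  immediate (neg ψ)   = SB-canonical ψ
  immediate (or ψ χ)  = SB-canonical ψ , SB-canonical χ
  immediate (next ψ)  = SB-canonical ψ
  immediate (fin ψ)   = SB-canonical ψ

  clauseCB : ClauseCB
  clauseCB X c i at cb with lower (to (familyOf-⇔ InCB _) cb)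
  ... | i' , ψ , at' , sc with StateAt-unique at at'
  ... | refl , refl = CBStep→CBUnfold ψ (scoped⇒CBStep ψ sc)

  clauseSB : ClauseSB
  clauseSB X c i at cb with lower (to (familyOf-⇔ InCB _) cb)
  ... | i' , ψ , at' , sc with StateAt-unique at at'
  ... | refl , refl =
    ⇔-trans (SB-canonical ψ X i at cb)
   (⇔-trans (⇔-sym (SBStep⇔SatB ψ (immediate ψ) (scoped⇒CBStep ψ sc)))
            (⇔-sym (SBUnfold⇔SBStep ψ)))

  assignStep : ∀ {X i π φ} Y → ScopedF (insert π (X ∋[ slotDom ]_)) (λ q → X ∋[ slotSDom ] toℕ q) φ →
               satF (tracesAt 𝒯 X) (assignmentOf X [ π ↦ decodeTrace Y ]ₐ) i φ → AssignStep X (code φ) i π Y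
  assignStep {X} {i} {π} {φ} Y sc s =
    X' , stateWith-at k , update , same , from (familyOf-⇔ InS _) (i , φ , stateWith-at k , sc' , s')
    where
    X'   = assigned k X (code φ) i π Y
    update = assigned-update k X (code φ) i π Y
    same = assigned-same k X (code φ) i π Y
    sc'  = ScopedF-mono (λ ρ → from (update-dom update ρ)) (λ q → from (same-sdom same (toℕ q))) φ sc
    s'   = satF-cong (≋-sym (tracesAt-same same)) (≈ₐ-sym (assignmentOf-update update)) i φ s

  substStep : ∀ {X i} q φ Y → ScopedF (X ∋[ slotDom ]_) (insert q (λ q → X ∋[ slotSDom ] toℕ q)) φ →
              satF (tracesAt 𝒯 X [ q ↦ Y ]ₛ) (assignmentOf X) i φ → SubstStep X (code φ) i (toℕ q) Y
  substStep {X} {i} q φ Y sc s =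
    X' , stateWith-at k , same , update , from (familyOf-⇔ InS _) (i , φ , stateWith-at k , sc' , s')
    where
    X'   = substituted k X (code φ) i (toℕ q) Y
    update = substituted-update k X (code φ) i (toℕ q) Y
    same = substituted-same k X (code φ) i (toℕ q) Y
    sc'  = ScopedF-mono (λ ρ → from (same-dom same ρ)) (λ r → from (update-sdom update (toℕ r)) ∘ map₁ (cong toℕ)) φ sc
    s'   = satF-cong (≋-sym (tracesAt-update q update)) (≈ₐ-sym (assignmentOf-same same)) i φ s

  step : ∀ {X i} φ → ScopedFAt X φ → SatF 𝒯 X i φ → SStep X φ i
  step {i = i} (exT π φ) sc (t , t∈ , s) =
    encodeTrace k t , TraceAt-complete k t∈ ,
    assignStep (encodeTrace k t) sc (satF-cong ≋-refl ([↦]ₐ-cong π ≈ₐ-refl (≈ₜ-sym (decode-encode k t))) i φ s)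
  step (allT π φ) sc s Y tr = assignStep Y sc (s (decodeTrace Y) (TraceAt-sound tr))
  step (exP q φ) sc (Y , s) = Y , substStep q φ Y sc s
  step (allP q φ) sc s Y = substStep q φ Y sc (s Y)
  step (body ψ) sc (lift s) = SatB→BodyStep ψ (SB-canonical ψ) (AllCB-scoped ψ sc) s

  clauseS : ClauseS
  clauseS X c i at s with to (familyOf-⇔ InS _) s
  ... | i' , φ , at' , sc , sat with StateAt-unique at at'
  ... | refl , refl = SStep→SUnfold φ (step φ sc sat)

  certificate : ∀ φ → Sentence φ → Σ _ T → T ⊨ φ → Certificate k (code φ)
  certificate φ closed (t , t∈T) sat = record
    { 𝒯 = 𝒯 ; S = S ; CB = CB ; SB = SB
    ; clauseS = clauseS ; clauseCB = clauseCB ; clauseSB = clauseSB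
    ; nonempty = encodeTrace k t , from (familyOf-⇔ InT (encodeTrace k t)) (lift (t , t∈T , decode-encode k t))
    ; initial  = X₀ , stateWith-at k , noDom , noSDom ,
                 from (familyOf-⇔ InS _) (0 , φ , stateWith-at k , ClosedF⇒ScopedF (λ _ ()) (λ _ ()) φ closed , sat₀)
    }
    where
    ∅ : ℕ → Set
    ∅ _ = ⊥
    X₀ = stateWith (code φ) 0 ∅ ∅ ∅ ∅
    noDom : ∀ ρ → X₀ ∋[ slotDom ] ρ → ⊥
    noDom ρ = to (mkState-∋ (slots (code φ) 0 ∅ ∅ ∅ ∅) slotDom ρ)
    noSDom : ∀ q → X₀ ∋[ slotSDom ] q → ⊥
    noSDom q = to (mkState-∋ (slots (code φ) 0 ∅ ∅ ∅ ∅) slotSDom q)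
    sat₀ : SatF 𝒯 X₀ 0 φ
    sat₀ = satF-cong (≋-sym (≋-trans (⟪⟫-cong ≋-refl (substOf-empty {X₀} noSDom))
                                     (≋-trans (⟪∅⟫ _) traceSetOf-𝒯)))
                     (≈ₐ-sym (assignmentOf-empty {X₀} noDom)) 0 φ sat

-- The Σ²₁ formula

-- First-order variables: 0 is the input n, 1 and 2 hold the constants 0 and 1,
-- 3 holds K; inside a clause 4 and 5 hold the code c and time i of the state
-- X = second-order variable 0. Numerals are built from the constants.
module SatFormula (k : ℕ) where

  𝔽 : Set
  𝔽 = Arith 4

  infixr 1 _⇒ₐ_ _⇔ₐ_
  _⇒ₐ_ _⇔ₐ_ : 𝔽 → 𝔽 → 𝔽
  a ⇒ₐ b = ¬ₐ a ∨ₐ b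
  a ⇔ₐ b = (a ⇒ₐ b) ∧ₐ (b ⇒ₐ a)

  num : ℕ → Term
  num zero    = var 1
  num (suc t) = var 2 ⊕ num t

  Kₜ cₜ iₜ : Term
  Kₜ = var 3
  cₜ = var 4
  iₜ = var 5

  encₜ : ℕ → Term → Term
  encₜ s y = num s ⊕ (y ⊗ num 6)

  linₜ : Term → Term → Term
  linₜ j r = r ⊕ (j ⊗ Kₜ)

  memₐ : ℕ → Term → ℕ → 𝔽
  memₐ s y X = encₜ s y ∈₂ X

  -- z = pair a b, via 2z = (a + b)² + (a + b) + 2b.
  Pairₐ : Term → Term → Term → 𝔽
  Pairₐ a b z = (z ⊕ z) ≐ ((((a ⊕ b) ⊗ (a ⊕ b)) ⊕ (a ⊕ b)) ⊕ (b ⊕ b))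

  Tag1 : ℕ → Term → Term → 𝔽
  Tag1 t a c = Pairₐ (num t) a c

  Tag2 : ℕ → Term → Term → Term → 𝔽
  Tag2 t a b c = ∃₁ 8 (Pairₐ a b (var 8) ∧ₐ Pairₐ (num t) (var 8) c)

  i𝒯 iS iCB iSB : Fin 4
  i𝒯 = f0
  iS = fs f0
  iCB = fs (fs f0)
  iSB = fs (fs (fs f0))

  StateAtₐ : ℕ → Term → Term → 𝔽
  StateAtₐ X c i = ∀₁ 9 (memₐ slotCode (var 9) X ⇔ₐ (var 9 ≐ c)) ∧ₐ
                   ∀₁ 9 (memₐ slotTime (var 9) X ⇔ₐ (var 9 ≐ i))

  SameAssignmentₐ : ℕ → ℕ → 𝔽
  SameAssignmentₐ X X' = ∀₁ 9 (memₐ slotDom (var 9) X' ⇔ₐ memₐ slotDom (var 9) X) ∧ₐ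
                         ∀₁ 9 (memₐ slotVal (var 9) X' ⇔ₐ memₐ slotVal (var 9) X)

  SameSubstₐ : ℕ → ℕ → 𝔽
  SameSubstₐ X X' = ∀₁ 9 (memₐ slotSDom (var 9) X' ⇔ₐ memₐ slotSDom (var 9) X) ∧ₐ
                    ∀₁ 9 (memₐ slotSVal (var 9) X' ⇔ₐ memₐ slotSVal (var 9) X)

  Refocusₐ : ℕ → ℕ → Term → Term → 𝔽
  Refocusₐ X X' d i = StateAtₐ X' d i ∧ₐ (SameAssignmentₐ X X' ∧ₐ SameSubstₐ X X')

  AssignUpdateₐ : ℕ → ℕ → Term → ℕ → 𝔽
  AssignUpdateₐ X X' π Y =
    ∀₁ 10 (memₐ slotDom (var 10) X' ⇔ₐ ((var 10 ≐ π) ∨ₐ memₐ slotDom (var 10) X)) ∧ₐ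
    ∀₁ 10 (∀₁ 11 (∃₁ 9 (Pairₐ (var 10) (var 11) (var 9) ∧ₐ
      (memₐ slotVal (var 9) X' ⇔ₐ
        (((var 10 ≐ π) ∧ₐ (var 11 ∈₂ Y)) ∨ₐ (¬ₐ (var 10 ≐ π) ∧ₐ memₐ slotVal (var 9) X))))))

  SubstUpdateₐ : ℕ → ℕ → Term → ℕ → 𝔽
  SubstUpdateₐ X X' q Y =
    ∀₁ 13 (memₐ slotSDom (var 13) X' ⇔ₐ ((var 13 ≐ q) ∨ₐ memₐ slotSDom (var 13) X)) ∧ₐ
    ∀₁ 12 (∀₁ 13 ((var 13 ≺ Kₜ) ⇒ₐ (memₐ slotSVal (linₜ (var 12) (var 13)) X' ⇔ₐ
      (((var 13 ≐ q) ∧ₐ (var 12 ∈₂ Y)) ∨ₐ (¬ₐ (var 13 ≐ q) ∧ₐ memₐ slotSVal (linₜ (var 12) (var 13)) X)))))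

  TraceAtₐ : ℕ → ℕ → 𝔽
  TraceAtₐ X Y = ∃₂ 5 ((5 ∈₃ i𝒯) ∧ₐ ∀₁ 12 (∀₁ 13 ((var 13 ≺ Kₜ) ⇒ₐ ((linₜ (var 12) (var 13) ∈₂ Y) ⇔ₐ
    ((memₐ slotSDom (var 13) X ∧ₐ memₐ slotSVal (linₜ (var 12) (var 13)) X) ∨ₐ
     (¬ₐ (memₐ slotSDom (var 13) X) ∧ₐ (linₜ (var 12) (var 13) ∈₂ 5)))))))

  AssignStepₐ : Term → Term → Term → ℕ → 𝔽
  AssignStepₐ c i π Y = ∃₂ 1 (StateAtₐ 1 c i ∧ₐ (AssignUpdateₐ 0 1 π Y ∧ₐ (SameSubstₐ 0 1 ∧ₐ (1 ∈₃ iS))))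

  SubstStepₐ : Term → Term → Term → ℕ → 𝔽
  SubstStepₐ c i q Y = ∃₂ 1 (StateAtₐ 1 c i ∧ₐ (SameAssignmentₐ 0 1 ∧ₐ (SubstUpdateₐ 0 1 q Y ∧ₐ (1 ∈₃ iS))))

  BodyStepₐ : Term → Term → 𝔽
  BodyStepₐ d i = ∃₂ 1 (Refocusₐ 0 1 d i ∧ₐ ((1 ∈₃ iCB) ∧ₐ (1 ∈₃ iSB)))

  AllCBₐ : Term → 𝔽
  AllCBₐ d = ∀₁ 19 (∀₂ 1 (Refocusₐ 0 1 d (var 19) ⇒ₐ (1 ∈₃ iCB)))

  ClauseSₐ : 𝔽
  ClauseSₐ = ∀₂ 0 (∀₁ 4 (∀₁ 5 ((StateAtₐ 0 cₜ iₜ ∧ₐ (0 ∈₃ iS)) ⇒ₐ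
               (exTₐ ∨ₐ (allTₐ ∨ₐ (exPₐ ∨ₐ (allPₐ ∨ₐ bodyₐ)))))))
    where
    exTₐ allTₐ exPₐ allPₐ bodyₐ : 𝔽
    exTₐ  = ∃₁ 6 (∃₁ 7 (Tag2 0 (var 6) (var 7) cₜ ∧ₐ ((var 7 ≺ cₜ) ∧ₐ
              ∃₂ 4 (TraceAtₐ 0 4 ∧ₐ AssignStepₐ (var 7) iₜ (var 6) 4))))
    allTₐ = ∃₁ 6 (∃₁ 7 (Tag2 1 (var 6) (var 7) cₜ ∧ₐ ((var 7 ≺ cₜ) ∧ₐ
              ∀₂ 4 (TraceAtₐ 0 4 ⇒ₐ AssignStepₐ (var 7) iₜ (var 6) 4))))
    exPₐ  = ∃₁ 17 (∃₁ 7 (Tag2 2 (var 17) (var 7) cₜ ∧ₐ ((var 17 ≺ Kₜ) ∧ₐ ((var 7 ≺ cₜ) ∧ₐ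
              ∃₂ 4 (SubstStepₐ (var 7) iₜ (var 17) 4)))))
    allPₐ = ∃₁ 17 (∃₁ 7 (Tag2 3 (var 17) (var 7) cₜ ∧ₐ ((var 17 ≺ Kₜ) ∧ₐ ((var 7 ≺ cₜ) ∧ₐ
              ∀₂ 4 (SubstStepₐ (var 7) iₜ (var 17) 4)))))
    bodyₐ = ∃₁ 14 (Tag1 4 (var 14) cₜ ∧ₐ ((var 14 ≺ cₜ) ∧ₐ BodyStepₐ (var 14) iₜ))

  ClauseCBₐ : 𝔽
  ClauseCBₐ = ∀₂ 0 (∀₁ 4 (∀₁ 5 ((StateAtₐ 0 cₜ iₜ ∧ₐ (0 ∈₃ iCB)) ⇒ₐ
                (apvₐ ∨ₐ (propₐ ∨ₐ (negₐ ∨ₐ (orₐ ∨ₐ (nextₐ ∨ₐ finₐ))))))))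
    where
    apvₐ propₐ negₐ orₐ nextₐ finₐ : 𝔽
    apvₐ  = ∃₁ 18 (∃₁ 6 (Tag2 0 (var 18) (var 6) cₜ ∧ₐ ((var 18 ≺ Kₜ) ∧ₐ memₐ slotDom (var 6) 0)))
    propₐ = ∃₁ 17 (Tag1 1 (var 17) cₜ ∧ₐ ((var 17 ≺ Kₜ) ∧ₐ memₐ slotSDom (var 17) 0))
    negₐ  = ∃₁ 14 (Tag1 2 (var 14) cₜ ∧ₐ ((var 14 ≺ cₜ) ∧ₐ AllCBₐ (var 14)))
    orₐ   = ∃₁ 15 (∃₁ 16 (Tag2 3 (var 15) (var 16) cₜ ∧ₐ ((var 15 ≺ cₜ) ∧ₐ ((var 16 ≺ cₜ) ∧ₐ
              (AllCBₐ (var 15) ∧ₐ AllCBₐ (var 16))))))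
    nextₐ = ∃₁ 14 (Tag1 4 (var 14) cₜ ∧ₐ ((var 14 ≺ cₜ) ∧ₐ AllCBₐ (var 14)))
    finₐ  = ∃₁ 14 (Tag1 5 (var 14) cₜ ∧ₐ ((var 14 ≺ cₜ) ∧ₐ AllCBₐ (var 14)))

  ClauseSBₐ : 𝔽
  ClauseSBₐ = ∀₂ 0 (∀₁ 4 (∀₁ 5 ((StateAtₐ 0 cₜ iₜ ∧ₐ (0 ∈₃ iCB)) ⇒ₐ
                ((0 ∈₃ iSB) ⇔ₐ (apvₐ ∨ₐ (propₐ ∨ₐ (negₐ ∨ₐ (orₐ ∨ₐ (nextₐ ∨ₐ finₐ)))))))))
    where
    apvₐ propₐ negₐ orₐ nextₐ finₐ : 𝔽
    apvₐ  = ∃₁ 18 (∃₁ 6 (Tag2 0 (var 18) (var 6) cₜ ∧ₐ ((var 18 ≺ Kₜ) ∧ₐ (memₐ slotDom (var 6) 0 ∧ₐ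
              ∃₁ 9 (Pairₐ (var 6) (linₜ iₜ (var 18)) (var 9) ∧ₐ memₐ slotVal (var 9) 0)))))
    propₐ = ∃₁ 17 (Tag1 1 (var 17) cₜ ∧ₐ ((var 17 ≺ Kₜ) ∧ₐ (memₐ slotSDom (var 17) 0 ∧ₐ
              ∀₂ 4 (TraceAtₐ 0 4 ⇒ₐ (linₜ iₜ (var 17) ∈₂ 4)))))
    negₐ  = ∃₁ 14 (Tag1 2 (var 14) cₜ ∧ₐ ∃₂ 1 (Refocusₐ 0 1 (var 14) iₜ ∧ₐ ((1 ∈₃ iCB) ∧ₐ ¬ₐ (1 ∈₃ iSB))))
    orₐ   = ∃₁ 15 (∃₁ 16 (Tag2 3 (var 15) (var 16) cₜ ∧ₐ ∃₂ 2 (∃₂ 3 (Refocusₐ 0 2 (var 15) iₜ ∧ₐ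
              (Refocusₐ 0 3 (var 16) iₜ ∧ₐ ((2 ∈₃ iCB) ∧ₐ ((3 ∈₃ iCB) ∧ₐ ((2 ∈₃ iSB) ∨ₐ (3 ∈₃ iSB)))))))))
    nextₐ = ∃₁ 14 (Tag1 4 (var 14) cₜ ∧ₐ BodyStepₐ (var 14) (var 2 ⊕ iₜ))
    finₐ  = ∃₁ 14 (Tag1 5 (var 14) cₜ ∧ₐ ∃₁ 20 (¬ₐ (var 20 ≺ iₜ) ∧ₐ BodyStepₐ (var 14) (var 20)))

  Nonemptyₐ Initialₐ Bodyₐ ψₐ : 𝔽
  Nonemptyₐ = ∃₂ 5 (5 ∈₃ i𝒯)
  Initialₐ  = ∃₂ 0 (StateAtₐ 0 (var 0) (var 1) ∧ₐ (∀₁ 10 (¬ₐ (memₐ slotDom (var 10) 0)) ∧ₐ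
                (∀₁ 10 (¬ₐ (memₐ slotSDom (var 10) 0)) ∧ₐ (0 ∈₃ iS))))
  Bodyₐ     = ClauseSₐ ∧ₐ (ClauseCBₐ ∧ₐ (ClauseSBₐ ∧ₐ (Nonemptyₐ ∧ₐ Initialₐ)))
  -- Terms have no constants: ψₐ first binds 0, 1 and K as the solutions of z + z = z,
  -- z < o ∧ o · o = o and K = 1 + ⋯ + 1 + 0.
  ψₐ        = ∃₁ 1 (((var 1 ⊕ var 1) ≐ var 1) ∧ₐ ∃₁ 2 (((var 1 ≺ var 2) ∧ₐ ((var 2 ⊗ var 2) ≐ var 2)) ∧ₐ
                ∃₁ 3 ((var 3 ≐ num (suc k)) ∧ₐ Bodyₐ)))

-- The meaning of the formulas of SatFormula k, written so that ⟦_⟧ computes to it: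
-- implication is ¬ A ⊎ B and pairing is its defining polynomial equation.
RImp : Set → Set → Set
RImp A B = ¬ A ⊎ B

RIff : Set → Set → Set
RIff A B = RImp A B × RImp B A

RawPair : ℕ → ℕ → ℕ → Set
RawPair a b z = z + z ≡ (a + b) * (a + b) + (a + b) + (b + b)

RawTag2 : ℕ → ℕ → ℕ → ℕ → Set
RawTag2 t a b c = Σ ℕ λ w → RawPair a b w × RawPair t w c

module Raw (k : ℕ) (𝒯 S CB SB : SetSetN) where
  open States k

  RStateAt : SetN → ℕ → ℕ → Set
  RStateAt X c i = (∀ y → RIff (X ∋[ slotCode ] y) (y ≡ c)) × (∀ y → RIff (X ∋[ slotTime ] y) (y ≡ i))

  RSameAssignment : SetN → SetN → Set
  RSameAssignment X X' = (∀ y → RIff (X' ∋[ slotDom ] y) (X ∋[ slotDom ] y)) ×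
                         (∀ y → RIff (X' ∋[ slotVal ] y) (X ∋[ slotVal ] y))

  RSameSubst : SetN → SetN → Set
  RSameSubst X X' = (∀ y → RIff (X' ∋[ slotSDom ] y) (X ∋[ slotSDom ] y)) ×
                    (∀ y → RIff (X' ∋[ slotSVal ] y) (X ∋[ slotSVal ] y))

  RRefocus : SetN → SetN → ℕ → ℕ → Set
  RRefocus X X' d i = RStateAt X' d i × (RSameAssignment X X' × RSameSubst X X')

  RAssignUpdate : SetN → SetN → ℕ → SetN → Set
  RAssignUpdate X X' π Y = (∀ ρ → RIff (X' ∋[ slotDom ] ρ) (ρ ≡ π ⊎ X ∋[ slotDom ] ρ)) ×
    (∀ ρ w → Σ ℕ λ z → RawPair ρ w z × RIff (X' ∋[ slotVal ] z) ((ρ ≡ π × Y w ≡ true) ⊎ (¬ ρ ≡ π × X ∋[ slotVal ] z)))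

  RSubstUpdate : SetN → SetN → ℕ → SetN → Set
  RSubstUpdate X X' q Y = (∀ r → RIff (X' ∋[ slotSDom ] r) (r ≡ q ⊎ X ∋[ slotSDom ] r)) ×
    (∀ j r → RImp (r < K) (RIff (X' ∋[ slotSVal ] lin j r)
                               ((r ≡ q × Y j ≡ true) ⊎ (¬ r ≡ q × X ∋[ slotSVal ] lin j r))))

  RTraceAt : SetN → SetN → Set
  RTraceAt X Y = Σ SetN λ Z → 𝒯 Z ≡ true × (∀ j r → RImp (r < K) (RIff (Y (lin j r) ≡ true)
    ((X ∋[ slotSDom ] r × X ∋[ slotSVal ] lin j r) ⊎ (¬ X ∋[ slotSDom ] r × Z (lin j r) ≡ true))))

  RAssignStep : SetN → ℕ → ℕ → ℕ → SetN → Set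
  RAssignStep X c i π Y = Σ SetN λ X' → RStateAt X' c i × (RAssignUpdate X X' π Y × (RSameSubst X X' × S X' ≡ true))

  RSubstStep : SetN → ℕ → ℕ → ℕ → SetN → Set
  RSubstStep X c i q Y = Σ SetN λ X' → RStateAt X' c i × (RSameAssignment X X' × (RSubstUpdate X X' q Y × S X' ≡ true))

  RBodyStep : SetN → ℕ → ℕ → Set
  RBodyStep X d i = Σ SetN λ X' → RRefocus X X' d i × (CB X' ≡ true × SB X' ≡ true)

  RAllCB : SetN → ℕ → Set
  RAllCB X d = ∀ i X' → RImp (RRefocus X X' d i) (CB X' ≡ true)

  RSUnfold : SetN → ℕ → ℕ → Set
  RSUnfold X c i =
      (Σ ℕ λ π → Σ ℕ λ c' → RawTag2 0 π c' c × (c' < c × Σ SetN λ Y → RTraceAt X Y × RAssignStep X c' i π Y))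
    ⊎ ((Σ ℕ λ π → Σ ℕ λ c' → RawTag2 1 π c' c × (c' < c × (∀ Y → RImp (RTraceAt X Y) (RAssignStep X c' i π Y))))
    ⊎ ((Σ ℕ λ q → Σ ℕ λ c' → RawTag2 2 q c' c × (q < K × (c' < c × Σ SetN λ Y → RSubstStep X c' i q Y)))
    ⊎ ((Σ ℕ λ q → Σ ℕ λ c' → RawTag2 3 q c' c × (q < K × (c' < c × (∀ Y → RSubstStep X c' i q Y))))
    ⊎ (Σ ℕ λ d → RawPair 4 d c × (d < c × RBodyStep X d i)))))

  RCBUnfold : SetN → ℕ → Set
  RCBUnfold X c =
      (Σ ℕ λ p → Σ ℕ λ π → RawTag2 0 p π c × (p < K × X ∋[ slotDom ] π))
    ⊎ ((Σ ℕ λ q → RawPair 1 q c × (q < K × X ∋[ slotSDom ] q))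
    ⊎ ((Σ ℕ λ d → RawPair 2 d c × (d < c × RAllCB X d))
    ⊎ ((Σ ℕ λ d₁ → Σ ℕ λ d₂ → RawTag2 3 d₁ d₂ c × (d₁ < c × (d₂ < c × (RAllCB X d₁ × RAllCB X d₂))))
    ⊎ ((Σ ℕ λ d → RawPair 4 d c × (d < c × RAllCB X d))
    ⊎ (Σ ℕ λ d → RawPair 5 d c × (d < c × RAllCB X d))))))

  RSBUnfold : SetN → ℕ → ℕ → Set
  RSBUnfold X c i =
      (Σ ℕ λ p → Σ ℕ λ π → RawTag2 0 p π c × (p < K × (X ∋[ slotDom ] π ×
         Σ ℕ λ z → RawPair π (lin i p) z × X ∋[ slotVal ] z)))
    ⊎ ((Σ ℕ λ q → RawPair 1 q c × (q < K × (X ∋[ slotSDom ] q × (∀ Y → RImp (RTraceAt X Y) (Y (lin i q) ≡ true)))))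
    ⊎ ((Σ ℕ λ d → RawPair 2 d c × Σ SetN λ X' → RRefocus X X' d i × (CB X' ≡ true × ¬ SB X' ≡ true))
    ⊎ ((Σ ℕ λ d₁ → Σ ℕ λ d₂ → RawTag2 3 d₁ d₂ c × Σ SetN λ X₁ → Σ SetN λ X₂ → RRefocus X X₁ d₁ i ×
         (RRefocus X X₂ d₂ i × (CB X₁ ≡ true × (CB X₂ ≡ true × (SB X₁ ≡ true ⊎ SB X₂ ≡ true)))))
    ⊎ ((Σ ℕ λ d → RawPair 4 d c × RBodyStep X d (suc i))
    ⊎ (Σ ℕ λ d → RawPair 5 d c × Σ ℕ λ j → ¬ j < i × RBodyStep X d j)))))

  RClauseS RClauseCB RClauseSB : Set
  RClauseS  = ∀ X c i → RImp (RStateAt X c i × S X ≡ true) (RSUnfold X c i)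
  RClauseCB = ∀ X c i → RImp (RStateAt X c i × CB X ≡ true) (RCBUnfold X c)
  RClauseSB = ∀ X c i → RImp (RStateAt X c i × CB X ≡ true) (RIff (SB X ≡ true) (RSBUnfold X c i))

  RInitial : ℕ → Set
  RInitial n = Σ SetN λ X₀ → RStateAt X₀ n 0 ×
    ((∀ ρ → ¬ X₀ ∋[ slotDom ] ρ) × ((∀ q → ¬ X₀ ∋[ slotSDom ] q) × S X₀ ≡ true))

  RBody : ℕ → Set
  RBody n = RClauseS × (RClauseCB × (RClauseSB × ((Σ SetN λ Z → 𝒯 Z ≡ true) × RInitial n)))

module _ (k : ℕ) where
  open SatFormula k

  environment : ℕ → ℕ → ℕ
  environment n = upd (upd (upd (upd (λ _ → 0) 0 n) 1 0) 2 1) 3 (suc k)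

  ⟦Bodyₐ⟧≡RBody : ∀ n 𝒴 → ⟦ Bodyₐ ⟧ (environment n) (λ _ _ → false) 𝒴 ≡
                          Raw.RBody k (𝒴 i𝒯) (𝒴 iS) (𝒴 iCB) (𝒴 iSB) n
  ⟦Bodyₐ⟧≡RBody n 𝒴 = refl

tri-double : ∀ s → tri s + tri s ≡ s * s + s
tri-double zero    = refl
tri-double (suc s) = begin
  (suc s + tri s) + (suc s + tri s) ≡⟨ regroup (suc s) (tri s) ⟩
  (suc s + suc s) + (tri s + tri s) ≡⟨ cong (suc s + suc s +_) (tri-double s) ⟩
  (suc s + suc s) + (s * s + s)     ≡⟨ square s ⟩
  suc s * suc s + suc s             ∎
  where
  open ≡-Reasoning
  regroup : ∀ a t → (a + t) + (a + t) ≡ (a + a) + (t + t)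
  regroup = solve-∀
  square : ∀ s → (suc s + suc s) + (s * s + s) ≡ suc s * suc s + suc s
  square = solve-∀

double-injective : ∀ {x y} → x + x ≡ y + y → x ≡ y
double-injective {x} {y} e = *-cancelˡ-≡ x y 2 (begin
  2 * x  ≡⟨ cong (x +_) (+-identityʳ x) ⟩
  x + x  ≡⟨ e ⟩
  y + y  ≡⟨ cong (y +_) (+-identityʳ y) ⟨
  2 * y  ∎)
  where open ≡-Reasoning

pair-RawPair : ∀ a b → RawPair a b (pair a b)
pair-RawPair a b = begin
  (tri (a + b) + b) + (tri (a + b) + b) ≡⟨ regroup (tri (a + b)) b ⟩
  (tri (a + b) + tri (a + b)) + (b + b) ≡⟨ cong (_+ (b + b)) (tri-double (a + b)) ⟩
  (a + b) * (a + b) + (a + b) + (b + b) ∎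
  where
  open ≡-Reasoning
  regroup : ∀ t b → (t + b) + (t + b) ≡ (t + t) + (b + b)
  regroup = solve-∀

RawPair⇔ : ∀ a b z → RawPair a b z ⇔ z ≡ pair a b
RawPair⇔ a b z = mk⇔ (λ e → double-injective (trans e (sym (pair-RawPair a b)))) λ { refl → pair-RawPair a b }

RawTag2⇔ : ∀ t a b c → RawTag2 t a b c ⇔ c ≡ pair t (pair a b)
RawTag2⇔ t a b c = mk⇔
  (λ (w , ab≡w , tw≡c) → trans (to (RawPair⇔ t w c) tw≡c) (cong (pair t) (to (RawPair⇔ a b w) ab≡w)))
  (λ e → pair a b , pair-RawPair a b , from (RawPair⇔ t (pair a b) c) e)

Σ-⇔ : ∀ {a} {I : Set a} {P Q : I → Set} → (∀ x → P x ⇔ Q x) → Σ I P ⇔ Σ I Q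
Σ-⇔ h = mk⇔ (λ (x , p) → x , to (h x) p) (λ (x , q) → x , from (h x) q)

Π-⇔ : ∀ {a} {I : Set a} {P Q : I → Set} → (∀ x → P x ⇔ Q x) → (∀ x → P x) ⇔ (∀ x → Q x)
Π-⇔ h = mk⇔ (λ f x → to (h x) (f x)) (λ f x → from (h x) (f x))

⇔-cong-⇔ : ∀ {A A' B B' : Set} → A ⇔ A' → B ⇔ B' → (A ⇔ B) ⇔ (A' ⇔ B')
⇔-cong-⇔ A⇔A' B⇔B' = mk⇔
  (λ A⇔B → ⇔-trans (⇔-sym A⇔A') (⇔-trans A⇔B B⇔B'))
  (λ A'⇔B' → ⇔-trans A⇔A' (⇔-trans A'⇔B' (⇔-sym B⇔B')))

RawPair-Σ⇔ : ∀ a b (P : ℕ → Set) → (Σ ℕ λ z → RawPair a b z × P z) ⇔ P (pair a b)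
RawPair-Σ⇔ a b P = mk⇔ (λ (z , r , p) → subst P (to (RawPair⇔ a b z) r) p) (λ p → pair a b , pair-RawPair a b , p)

≮⇔≥ : ∀ {i j} → (¬ j < i) ⇔ (i ≤ j)
≮⇔≥ = mk⇔ ≮⇒≥ ≤⇒≯

module Faithfulness (em : ExcludedMiddle (lsuc lzero)) (k : ℕ) (𝒯 S CB SB : SetSetN) where
  open States k
  open Clauses k 𝒯 S CB SB
  open Raw k 𝒯 S CB SB

  RImp⇔ : ∀ {A B} → RImp A B ⇔ (A → B)
  RImp⇔ {A} = mk⇔ (λ { (inj₁ ¬a) a → contradiction a ¬a ; (inj₂ b) _ → b }) classical
    where
    classical : ∀ {B} → (A → B) → RImp A B
    classical f with em {Lift (lsuc lzero) A}
    ... | yes (lift a) = inj₂ (f a)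
    ... | no ¬a        = inj₁ (λ a → ¬a (lift a))

  RIff⇔ : ∀ {A B} → RIff A B ⇔ (A ⇔ B)
  RIff⇔ = mk⇔ (λ (f , g) → mk⇔ (to RImp⇔ f) (to RImp⇔ g)) (λ e → from RImp⇔ (to e) , from RImp⇔ (from e))

  RIff-∀⇔ : ∀ {P Q : ℕ → Set} → (∀ y → RIff (P y) (Q y)) ⇔ (∀ y → P y ⇔ Q y)
  RIff-∀⇔ = Π-⇔ λ _ → RIff⇔

  RImp-RIff⇔ : ∀ {A B C} → RImp A (RIff B C) ⇔ (A → B ⇔ C)
  RImp-RIff⇔ = ⇔-trans RImp⇔ (→-cong-⇔ (⇔-id _) RIff⇔)

  RStateAt⇔ : ∀ X c i → RStateAt X c i ⇔ StateAt X c i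
  RStateAt⇔ X c i = mk⇔
    (λ (a , b) → record { at-code = to RIff-∀⇔ a ; at-time = to RIff-∀⇔ b })
    (λ r → from RIff-∀⇔ (at-code r) , from RIff-∀⇔ (at-time r))

  RSameAssignment⇔ : ∀ X X' → RSameAssignment X X' ⇔ SameAssignment X X'
  RSameAssignment⇔ X X' = mk⇔
    (λ (a , b) → record { same-dom = to RIff-∀⇔ a ; same-val = to RIff-∀⇔ b })
    (λ r → from RIff-∀⇔ (same-dom r) , from RIff-∀⇔ (same-val r))

  RSameSubst⇔ : ∀ X X' → RSameSubst X X' ⇔ SameSubst X X'
  RSameSubst⇔ X X' = mk⇔
    (λ (a , b) → record { same-sdom = to RIff-∀⇔ a ; same-sval = to RIff-∀⇔ b })
    (λ r → from RIff-∀⇔ (same-sdom r) , from RIff-∀⇔ (same-sval r))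

  RRefocus⇔ : ∀ X X' d i → RRefocus X X' d i ⇔ Refocus X X' d i
  RRefocus⇔ X X' d i = mk⇔
    (λ (a , b , c) → record { refocus-at = to (RStateAt⇔ X' d i) a
                            ; refocus-assign = to (RSameAssignment⇔ X X') b
                            ; refocus-subst = to (RSameSubst⇔ X X') c })
    (λ r → from (RStateAt⇔ X' d i) (refocus-at r) ,
           from (RSameAssignment⇔ X X') (refocus-assign r) , from (RSameSubst⇔ X X') (refocus-subst r))

  RAssignUpdate⇔ : ∀ X X' π Y → RAssignUpdate X X' π Y ⇔ AssignUpdate X X' π Y
  RAssignUpdate⇔ X X' π Y = mk⇔
    (λ (a , b) → record { update-dom = to RIff-∀⇔ a ; update-val = λ ρ w → to (val⇔ ρ w) (b ρ w) })
    (λ r → from RIff-∀⇔ (update-dom r) , λ ρ w → from (val⇔ ρ w) (update-val r ρ w))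
    where
    val⇔ : ∀ ρ w → _ ⇔ _
    val⇔ ρ w = ⇔-trans (RawPair-Σ⇔ ρ w λ z →
      RIff (X' ∋[ slotVal ] z) ((ρ ≡ π × Y w ≡ true) ⊎ (¬ ρ ≡ π × X ∋[ slotVal ] z))) RIff⇔

  RSubstUpdate⇔ : ∀ X X' q Y → RSubstUpdate X X' q Y ⇔ SubstUpdate X X' q Y
  RSubstUpdate⇔ X X' q Y = mk⇔
    (λ (a , b) → record { update-sdom = to RIff-∀⇔ a ; update-sval = λ j r → to RImp-RIff⇔ (b j r) })
    (λ u → from RIff-∀⇔ (update-sdom u) , λ j r → from RImp-RIff⇔ (update-sval u j r))

  RTraceAt⇔ : ∀ X Y → RTraceAt X Y ⇔ TraceAt 𝒯 X Y
  RTraceAt⇔ X Y = mk⇔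
    (λ (Z , Z∈𝒯 , ov) → record { source = Z ; source∈𝒯 = Z∈𝒯 ; overrides = λ j r → to RImp-RIff⇔ (ov j r) })
    (λ tr → source tr , source∈𝒯 tr , λ j r → from RImp-RIff⇔ (overrides tr j r))

  RAssignStep⇔ : ∀ X c i π Y → RAssignStep X c i π Y ⇔ AssignStep X c i π Y
  RAssignStep⇔ X c i π Y = Σ-⇔ λ X' →
    RStateAt⇔ X' c i ×-⇔ RAssignUpdate⇔ X X' π Y ×-⇔ RSameSubst⇔ X X' ×-⇔ ⇔-id _

  RSubstStep⇔ : ∀ X c i q Y → RSubstStep X c i q Y ⇔ SubstStep X c i q Y
  RSubstStep⇔ X c i q Y = Σ-⇔ λ X' →
    RStateAt⇔ X' c i ×-⇔ RSameAssignment⇔ X X' ×-⇔ RSubstUpdate⇔ X X' q Y ×-⇔ ⇔-id _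

  RBodyStep⇔ : ∀ X d i → RBodyStep X d i ⇔ BodyStep X d i
  RBodyStep⇔ X d i = Σ-⇔ λ X' → RRefocus⇔ X X' d i ×-⇔ ⇔-id _

  RAllCB⇔ : ∀ X d → RAllCB X d ⇔ AllCB X d
  RAllCB⇔ X d = Π-⇔ λ i → Π-⇔ λ X' → ⇔-trans RImp⇔ (→-cong-⇔ (RRefocus⇔ X X' d i) (⇔-id _))

  RSUnfold⇔ : ∀ X c i → RSUnfold X c i ⇔ SUnfold X c i
  RSUnfold⇔ X c i =
        (Σ-⇔ λ π → Σ-⇔ λ c' → RawTag2⇔ 0 π c' c ×-⇔ ⇔-id _ ×-⇔
           (Σ-⇔ λ Y → RTraceAt⇔ X Y ×-⇔ RAssignStep⇔ X c' i π Y))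
    ⊎-⇔ (Σ-⇔ λ π → Σ-⇔ λ c' → RawTag2⇔ 1 π c' c ×-⇔ ⇔-id _ ×-⇔
           (Π-⇔ λ Y → ⇔-trans RImp⇔ (→-cong-⇔ (RTraceAt⇔ X Y) (RAssignStep⇔ X c' i π Y))))
    ⊎-⇔ (Σ-⇔ λ q → Σ-⇔ λ c' → RawTag2⇔ 2 q c' c ×-⇔ ⇔-id _ ×-⇔ ⇔-id _ ×-⇔
           (Σ-⇔ λ Y → RSubstStep⇔ X c' i q Y))
    ⊎-⇔ (Σ-⇔ λ q → Σ-⇔ λ c' → RawTag2⇔ 3 q c' c ×-⇔ ⇔-id _ ×-⇔ ⇔-id _ ×-⇔
           (Π-⇔ λ Y → RSubstStep⇔ X c' i q Y))
    ⊎-⇔ (Σ-⇔ λ d → RawPair⇔ 4 d c ×-⇔ ⇔-id _ ×-⇔ RBodyStep⇔ X d i)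

  RCBUnfold⇔ : ∀ X c → RCBUnfold X c ⇔ CBUnfold X c
  RCBUnfold⇔ X c =
        (Σ-⇔ λ p → Σ-⇔ λ π → RawTag2⇔ 0 p π c ×-⇔ ⇔-id _)
    ⊎-⇔ (Σ-⇔ λ q → RawPair⇔ 1 q c ×-⇔ ⇔-id _)
    ⊎-⇔ (Σ-⇔ λ d → RawPair⇔ 2 d c ×-⇔ ⇔-id _ ×-⇔ RAllCB⇔ X d)
    ⊎-⇔ (Σ-⇔ λ d₁ → Σ-⇔ λ d₂ → RawTag2⇔ 3 d₁ d₂ c ×-⇔ ⇔-id _ ×-⇔ ⇔-id _ ×-⇔ RAllCB⇔ X d₁ ×-⇔ RAllCB⇔ X d₂)
    ⊎-⇔ (Σ-⇔ λ d → RawPair⇔ 4 d c ×-⇔ ⇔-id _ ×-⇔ RAllCB⇔ X d)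
    ⊎-⇔ (Σ-⇔ λ d → RawPair⇔ 5 d c ×-⇔ ⇔-id _ ×-⇔ RAllCB⇔ X d)

  RSBUnfold⇔ : ∀ X c i → RSBUnfold X c i ⇔ SBUnfold X c i
  RSBUnfold⇔ X c i =
        (Σ-⇔ λ p → Σ-⇔ λ π → RawTag2⇔ 0 p π c ×-⇔ ⇔-id _ ×-⇔ ⇔-id _ ×-⇔
           RawPair-Σ⇔ π (lin i p) (X ∋[ slotVal ]_))
    ⊎-⇔ (Σ-⇔ λ q → RawPair⇔ 1 q c ×-⇔ ⇔-id _ ×-⇔ ⇔-id _ ×-⇔
           (Π-⇔ λ Y → ⇔-trans RImp⇔ (→-cong-⇔ (RTraceAt⇔ X Y) (⇔-id _))))
    ⊎-⇔ (Σ-⇔ λ d → RawPair⇔ 2 d c ×-⇔ (Σ-⇔ λ X' → RRefocus⇔ X X' d i ×-⇔ ⇔-id _))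
    ⊎-⇔ (Σ-⇔ λ d₁ → Σ-⇔ λ d₂ → RawTag2⇔ 3 d₁ d₂ c ×-⇔
           (Σ-⇔ λ X₁ → Σ-⇔ λ X₂ → RRefocus⇔ X X₁ d₁ i ×-⇔ RRefocus⇔ X X₂ d₂ i ×-⇔ ⇔-id _))
    ⊎-⇔ (Σ-⇔ λ d → RawPair⇔ 4 d c ×-⇔ RBodyStep⇔ X d (suc i))
    ⊎-⇔ (Σ-⇔ λ d → RawPair⇔ 5 d c ×-⇔ (Σ-⇔ λ j → ≮⇔≥ ×-⇔ RBodyStep⇔ X d j))

  clause⇔ : ∀ {A A' B C C' : Set} → A ⇔ A' → C ⇔ C' → RImp (A × B) C ⇔ (A' → B → C')
  clause⇔ A⇔A' C⇔C' = ⇔-trans RImp⇔ (mk⇔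
    (λ f a b → to C⇔C' (f (from A⇔A' a , b)))
    (λ f (a , b) → from C⇔C' (f (to A⇔A' a) b)))

  RBody⇔ : ∀ n → RBody n ⇔ (ClauseS × ClauseCB × ClauseSB × (Σ SetN λ Z → 𝒯 Z ≡ true) × Initial n)
  RBody⇔ n =
        (Π-⇔ λ X → Π-⇔ λ c → Π-⇔ λ i → clause⇔ (RStateAt⇔ X c i) (RSUnfold⇔ X c i))
    ×-⇔ (Π-⇔ λ X → Π-⇔ λ c → Π-⇔ λ i → clause⇔ (RStateAt⇔ X c i) (RCBUnfold⇔ X c))
    ×-⇔ (Π-⇔ λ X → Π-⇔ λ c → Π-⇔ λ i → clause⇔ (RStateAt⇔ X c i) (⇔-trans RIff⇔ (⇔-cong-⇔ (⇔-id _) (RSBUnfold⇔ X c i))))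
    ×-⇔ ⇔-id _
    ×-⇔ (Σ-⇔ λ X₀ → RStateAt⇔ X₀ n 0 ×-⇔ ⇔-id _)

idempotent-pos : ∀ {x} → 0 < x → x * x ≡ x → x ≡ 1
idempotent-pos {suc y} _ e = *-cancelʳ-≡ (suc y) 1 (suc y) (trans e (sym (*-identityˡ (suc y))))

module _ (em : ExcludedMiddle (lsuc lzero)) (k : ℕ) where
  open SatFormula k

  num-eval : ∀ e t → e 1 ≡ 0 → e 2 ≡ 1 → evalT e (num t) ≡ t
  num-eval e zero    e1 _  = e1
  num-eval e (suc t) e1 e2 = cong₂ _+_ e2 (num-eval e t e1 e2)

  Σ21⇒Certificate : ∀ n → Σ21holds ψₐ n → Certificate k n
  Σ21⇒Certificate n (𝒴 , z , z+z≡z , o , (z<o , o*o≡o) , K' , K'≡ , ⟦Body⟧)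
    with +-cancelʳ-≡ z z 0 z+z≡z
  ... | refl with idempotent-pos z<o o*o≡o
  ... | refl with trans K'≡ (num-eval (upd (upd (upd (upd (λ _ → 0) 0 n) 1 0) 2 1) 3 K') (suc k) refl refl)
  ... | refl =
    let (cS , cCB , cSB , ne , init) = to (RBody⇔ n) (subst id (⟦Bodyₐ⟧≡RBody k n 𝒴) ⟦Body⟧)
    in record { clauseS = cS ; clauseCB = cCB ; clauseSB = cSB ; nonempty = ne ; initial = init }
    where open Faithfulness em k (𝒴 i𝒯) (𝒴 iS) (𝒴 iCB) (𝒴 iSB)

  Certificate⇒Σ21 : ∀ n → Certificate k n → Σ21holds ψₐ n
  Certificate⇒Σ21 n cert =
    𝒴 , 0 , refl , 1 , (s≤s z≤n , refl) , suc k , sym (num-eval (environment k n) (suc k) refl refl) ,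
    subst id (sym (⟦Bodyₐ⟧≡RBody k n 𝒴)) (from (RBody⇔ n) (clauseS , clauseCB , clauseSB , nonempty , initial))
    where
    open Certificate cert
    open Faithfulness em k 𝒯 S CB SB
    𝒴 : Fin 4 → SetSetN
    𝒴 f0                = 𝒯
    𝒴 (fs f0)           = S
    𝒴 (fs (fs f0))      = CB
    𝒴 (fs (fs (fs f0))) = SB

  SatProblem⇒Certificate : ∀ n → SatProblem k n → Certificate k n
  SatProblem⇒Certificate _ (φ , refl , closed , T , nonempty , T⊨φ) =
    Completeness.certificate em k T φ closed nonempty T⊨φ

lemma3 : ExcludedMiddle (lsuc lzero) → (k : ℕ) → InΣ21 (SatProblem k)
lemma3 em k = 4 , SatFormula.ψₐ k , λ n →
  (λ sat → Certificate⇒Σ21 em k n (SatProblem⇒Certificate em k n sat)) ,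
  (λ σ → Soundness.satisfiable em k n (Σ21⇒Certificate em k n σ))
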